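{- Let $m\ge 3$ and $q\ge 1$ be integers and let $\boldsymbol w=(w_1,\dots,w_m)\in\{2,3,\dots,q+1\}^m$. Let $H_{\boldsymbol w}$ be the multigraph constructed as follows: take a root vertex $\rho$ and two paths $u_1-u_2-\cdots-u_m$ and $u'_1-u'_2-\cdots-u'_{m-1}$, disjoint from each other and from $\rho$; for $1\le i\le m$ add $w_i-\delta_i^{(m)}$ parallel edges between $u_i$ and $\rho$, and for $1\le i\le m-1$ add $w_i-\delta_i^{(m-1)}$ parallel edges between $u'_i$ and $\rho$; there are no other edges. Then \[ \tau(H_{\boldsymbol w})=K_m(w_1,\dots,w_m)\,K_{m-1}(w_1,\dots,w_{m-1}). \]
   Context: For $r\ge1$ and $i\in\{1,\dots,r\}$, $\delta_i^{(r)}=\mathbf 1_{i>1}+\mathbf 1_{i<r}$ is the degree of vertex $i$ in the path $1-2-\cdots-r$. $\tau$ denotes the number of spanning trees (of a multigraph, counting parallel edges as distinct). For integers $x_1,\dots,x_r$, the continuant $K_r(x_1,\dots,x_r)$ is defined by $K_0=1$, $K_1(x_1)=x_1$, and $K_i(x_1,\dots,x_i)=x_iK_{i-1}(x_1,\dots,x_{i-1})-K_{i-2}(x_1,\dots,x_{i-2})$ for $i\ge2$; equivalently it is the determinant of the $r\times r$ tridiagonal matrix with diagonal $x_1,\dots,x_r$ and off-diagonal entries $-1$. -}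

module Defs where

open import Data.Nat using (ℕ; zero; suc; _∸_; _<ᵇ_)
open import Data.Integer as ℤ using (ℤ; +_)
open import Data.Bool using (Bool; if_then_else_)
open import Data.Fin using (Fin; zero; suc; toℕ)
open import Data.Fin.Subset using (Subset; _∈_; _-_)
open import Data.List using (List; []; _∷_; map; _++_; concatMap; replicate; length; allFin; lookup)
open import Data.List.Membership.Propositional using () renaming (_∈_ to _∈ₗ_)
open import Data.List.Relation.Unary.Unique.Propositional using (Unique)
open import Data.Product using (Σ; _×_; _,_; proj₁; proj₂)
open import Relation.Binary.PropositionalEquality using (_≡_)
open import Relation.Nullary using (¬_)

-- Continuant K_r(x_1,…,x_r), with the sequence given 0-indexed:
-- K r x = K_r(x 0, …, x (r-1)).

K : ℕ → (ℕ → ℤ) → ℤ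
K zero x = + 1
K (suc zero) x = x 0
K (suc (suc r)) x = x (suc r) ℤ.* K (suc r) x ℤ.- K r x

-- δ_i^{(r)} for the 0-indexed vertex i : Fin r of the path on r vertices
-- (1-based vertex toℕ i + 1):  1_{i>1} + 1_{i<r}.
δ : (r : ℕ) → Fin r → ℕ
δ r i = first i Data.Nat.+ (if suc (toℕ i) <ᵇ r then 1 else 0)
  where
  first : ∀ {n} → Fin n → ℕ
  first zero = 0
  first (suc _) = 1

-- Finite multigraphs: a vertex type V and a list of edges (pairs of
-- endpoints); edges are indexed by Fin (length G), parallel edges are
-- distinct list entries.

Multigraph : Set → Set
Multigraph V = List (V × V)

EdgeSubset : ∀ {V} → Multigraph V → Set
EdgeSubset G = Subset (length G)

ends : ∀ {V} (G : Multigraph V) → Fin (length G) → V × V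
ends G e = lookup G e

data Reach {V : Set} (G : Multigraph V) (S : EdgeSubset G) : V → V → Set where
  here : ∀ {x} → Reach G S x x
  fwd  : ∀ {x y} (e : Fin (length G)) → e ∈ S → proj₁ (ends G e) ≡ x →
         Reach G S (proj₂ (ends G e)) y → Reach G S x y
  bwd  : ∀ {x y} (e : Fin (length G)) → e ∈ S → proj₂ (ends G e) ≡ x →
         Reach G S (proj₁ (ends G e)) y → Reach G S x y

Connected : ∀ {V} (G : Multigraph V) → EdgeSubset G → Set
Connected {V} G S = (x y : V) → Reach G S x y

-- The spanning subgraph (V, S) is acyclic: no edge of S lies on a cycle,
-- i.e. for every e ∈ S its endpoints are not joined in S ∖ {e}.
-- (Loops and pairs of parallel edges are cycles under this definition.)
Acyclic : ∀ {V} (G : Multigraph V) → EdgeSubset G → Set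
Acyclic G S = ∀ e → e ∈ S → ¬ Reach G (S - e) (proj₁ (ends G e)) (proj₂ (ends G e))

IsSpanningTree : ∀ {V} (G : Multigraph V) → EdgeSubset G → Set
IsSpanningTree G S = Connected G S × Acyclic G S

HasSpanningTreeCount : ∀ {V} (G : Multigraph V) → ℕ → Set
HasSpanningTreeCount G n =
  Σ (List (EdgeSubset G)) λ ts →
    Unique ts ×
    ((S : EdgeSubset G) → (S ∈ₗ ts → IsSpanningTree G S) × (IsSpanningTree G S → S ∈ₗ ts)) ×
    length ts ≡ n

-- vertices: ρ, u_1..u_m (top i), u'_1..u'_{m-1} (bot j), 0-indexed
data Vtx (m : ℕ) : Set where
  ρ   : Vtx m
  top : Fin m → Vtx m
  bot : Fin (m ∸ 1) → Vtx m

pathEdges : (n : ℕ) → List (Fin n × Fin n)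
pathEdges zero = []
pathEdges (suc zero) = []
pathEdges (suc (suc n)) = (zero , suc zero) ∷ map (λ p → suc (proj₁ p) , suc (proj₂ p)) (pathEdges (suc n))

-- w is given 0-indexed: w i = w_{i+1}
H : (m : ℕ) → (ℕ → ℕ) → Multigraph (Vtx m)
H m w =
  map (λ p → top (proj₁ p) , top (proj₂ p)) (pathEdges m) ++
  map (λ p → bot (proj₁ p) , bot (proj₂ p)) (pathEdges (m ∸ 1)) ++
  concatMap (λ i → replicate (w (toℕ i) ∸ δ m i) (top i , ρ)) (allFin m) ++
  concatMap (λ j → replicate (w (toℕ j) ∸ δ (m ∸ 1) j) (bot j , ρ)) (allFin (m ∸ 1))

{-# OPTIONS --safe #-}
module Submission where

-- The root ρ is a cut vertex of H_w, so the spanning trees of H_w are the pairs of a spanning tree of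
-- the fan formed by ρ and u₁ … u_m and one of the fan formed by ρ and u′₁ … u′_{m-1}.  In a fan, a set
-- of path edges and spokes is a spanning tree exactly when every maximal run of consecutive vertices
-- joined by path edges carries exactly one spoke.  Scanning the path from left to right, these trees
-- are the words of a two-state automaton (does the current run have its spoke yet?), and since vertex
-- i has w_i − δ_i spokes, the transfer recursion counting the words is the continuant recursion in the w_i.

open import Data.Nat using (ℕ)

module Lists where
  open import Data.Nat using (_+_; _*_)
  open import Data.List using ([]; _∷_; map; _++_; length; cartesianProductWith)
  open import Data.List.Properties using (length-map; length-++)
  open import Relation.Binary.PropositionalEquality

  length-cartesianProductWith : ∀ {A B C : Set} (f : A → B → C) xs ys →
    length (cartesianProductWith f xs ys) ≡ length xs * length ys
  length-cartesianProductWith f [] ys = refl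
  length-cartesianProductWith f (x ∷ xs) ys = begin
    length (map (f x) ys ++ cartesianProductWith f xs ys)
      ≡⟨ length-++ (map (f x) ys) ⟩
    length (map (f x) ys) + length (cartesianProductWith f xs ys)
      ≡⟨ cong₂ _+_ (length-map (f x) ys) (length-cartesianProductWith f xs ys) ⟩
    length ys + length xs * length ys ∎
    where open ≡-Reasoning

module Multigraphs where
  open import Defs
  open import Data.Bool using (false)
  open import Data.Fin using (Fin; zero; suc)
  open import Data.Fin.Subset using (Subset; inside; outside; _∈_; _∉_; _-_; ⁅_⁆)
  open import Data.Fin.Subset.Properties using (p─q⊆p)
  open import Data.List using (List; length; map)
  open import Data.List.Properties using (length-map)
  open import Data.List.Membership.Propositional using () renaming (_∈_ to _∈ₗ_)
  open import Data.List.Membership.Propositional.Properties using (∈-map⁺; ∈-map⁻)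
  open import Data.List.Relation.Unary.Unique.Propositional using (Unique)
  import Data.List.Relation.Unary.Unique.Propositional.Properties as Unique
  open import Data.Product using (Σ; _×_; _,_; proj₁; proj₂)
  open import Data.Vec using (_∷_; there; lookup)
  open import Data.Vec.Properties using ([]=⇒lookup)
  open import Function.Definitions using (Injective)
  open import Relation.Binary.PropositionalEquality
  open import Relation.Nullary using (¬_)

  x∉p-x : ∀ {n} (p : Subset n) (x : Fin n) → x ∉ p - x
  x∉p-x (inside ∷ p) zero ()
  x∉p-x (outside ∷ p) zero ()
  x∉p-x (_ ∷ p) (suc x) (there x∈p-x) = x∉p-x p x x∈p-x

  x∈p-y⇒x≢y : ∀ {n} {p : Subset n} {x y} → x ∈ p - y → x ≢ y
  x∈p-y⇒x≢y {p = p} {x} x∈p-x refl = x∉p-x p x x∈p-x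

  x∈p-y⇒x∈p : ∀ {n} {p : Subset n} {x y} → x ∈ p - y → x ∈ p
  x∈p-y⇒x∈p {p = p} {y = y} = p─q⊆p p ⁅ y ⁆

  lookup≡false⇒∉ : ∀ {n} {p : Subset n} {x} → lookup p x ≡ false → x ∉ p
  lookup≡false⇒∉ p[x]≡false x∈p with () ← trans (sym ([]=⇒lookup x∈p)) p[x]≡false

  ClosedAlong : ∀ {V : Set} → (V → Set) → V × V → Set
  ClosedAlong P xy = (P (proj₁ xy) → P (proj₂ xy)) × (P (proj₂ xy) → P (proj₁ xy))

  module _ {V : Set} (G : Multigraph V) where

    Reach-trans : ∀ {S x y z} → Reach G S x y → Reach G S y z → Reach G S x z
    Reach-trans here q = q
    Reach-trans (fwd e e∈S refl p) q = fwd e e∈S refl (Reach-trans p q)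
    Reach-trans (bwd e e∈S refl p) q = bwd e e∈S refl (Reach-trans p q)

    Reach-sym : ∀ {S x y} → Reach G S x y → Reach G S y x
    Reach-sym here = here
    Reach-sym (fwd e e∈S refl p) = Reach-trans (Reach-sym p) (bwd e e∈S refl here)
    Reach-sym (bwd e e∈S refl p) = Reach-trans (Reach-sym p) (fwd e e∈S refl here)

    edge⇒Reach : ∀ {S x y} e → e ∈ S → ends G e ≡ (x , y) → Reach G S x y
    edge⇒Reach e e∈S refl = fwd e e∈S refl here

    EdgeClosed : EdgeSubset G → (V → Set) → Set
    EdgeClosed S P = ∀ e → e ∈ S → ClosedAlong P (ends G e)

    Reach-preserves : ∀ {S P x y} → EdgeClosed S P → Reach G S x y → P x → P y
    Reach-preserves closed here px = px
    Reach-preserves closed (fwd e e∈S refl p) px = Reach-preserves closed p (proj₁ (closed e e∈S) px)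
    Reach-preserves closed (bwd e e∈S refl p) px = Reach-preserves closed p (proj₂ (closed e e∈S) px)

    Acyclic⇒¬Reach : ∀ {S e x y} → Acyclic G S → e ∈ S → ends G e ≡ (x , y) → ¬ Reach G (S - e) x y
    Acyclic⇒¬Reach acyclic e∈S refl = acyclic _ e∈S

    OnNoCycle : EdgeSubset G → Fin (length G) → Set
    OnNoCycle S e = ¬ Reach G (S - e) (proj₁ (ends G e)) (proj₂ (ends G e))

    ¬Reach⇒OnNoCycle : ∀ {S e x y} → ends G e ≡ (x , y) → ¬ Reach G (S - e) x y → OnNoCycle S e
    ¬Reach⇒OnNoCycle refl ¬reach = ¬reach

    spanningTreeCount : {A : Set} (xs : List A) → Unique xs → (∀ x → x ∈ₗ xs) →
      (code : A → EdgeSubset G) → Injective _≡_ _≡_ code →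
      (∀ x → IsSpanningTree G (code x)) →
      (∀ S → IsSpanningTree G S → Σ A λ x → code x ≡ S) →
      HasSpanningTreeCount G (length xs)
    spanningTreeCount xs unique complete code injective sound onto =
      map code xs , Unique.map⁺ injective unique , (λ S → listed⇒tree , tree⇒listed) , length-map code xs
      where
      listed⇒tree : ∀ {S} → S ∈ₗ map code xs → IsSpanningTree G S
      listed⇒tree S∈ with ∈-map⁻ code S∈
      ... | x , _ , refl = sound x
      tree⇒listed : ∀ {S} → IsSpanningTree G S → S ∈ₗ map code xs
      tree⇒listed {S} tree with onto S tree
      ... | x , refl = ∈-map⁺ code (complete x)

module Continuants where
  open import Defs
  open import Data.Nat using (ℕ; zero; suc)
  open import Data.Integer using (ℤ; +_; _*_; _-_)
  open import Data.Integer.Tactic.RingSolver using (solve-∀)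
  open import Function using (_∘_)
  open import Relation.Binary.PropositionalEquality

  K-cong : ∀ r {x y : ℕ → ℤ} → (∀ i → x i ≡ y i) → K r x ≡ K r y
  K-cong zero x≗y = refl
  K-cong (suc zero) x≗y = x≗y 0
  K-cong (suc (suc r)) x≗y =
    cong₂ _-_ (cong₂ _*_ (x≗y (suc r)) (K-cong (suc r) x≗y)) (K-cong r x≗y)

  K-unfoldˡ : ∀ r (x : ℕ → ℤ) → K (suc (suc r)) x ≡ x 0 * K (suc r) (x ∘ suc) - K r (x ∘ suc ∘ suc)
  K-unfoldˡ zero x = two (x 0) (x 1)
    where
    two : ∀ a b → b * a - + 1 ≡ a * b - + 1
    two = solve-∀
  K-unfoldˡ (suc zero) x = three (x 0) (x 1) (x 2)
    where
    three : ∀ a b c → c * (b * a - + 1) - a ≡ a * (c * b - + 1) - c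
    three = solve-∀
  K-unfoldˡ (suc (suc r)) x = begin
    X * K (suc (suc (suc r))) x - K (suc (suc r)) x
      ≡⟨ cong₂ (λ u v → X * u - v) (K-unfoldˡ (suc r) x) (K-unfoldˡ r x) ⟩
    X * (x 0 * A - B) - (x 0 * C - D)
      ≡⟨ regroup X (x 0) A B C D ⟩
    x 0 * (X * A - C) - (X * B - D) ∎
    where
    open ≡-Reasoning
    X = x (suc (suc (suc r)))
    A = K (suc (suc r)) (x ∘ suc)
    B = K (suc r) (x ∘ suc ∘ suc)
    C = K (suc r) (x ∘ suc)
    D = K r (x ∘ suc ∘ suc)
    regroup : ∀ X x₀ A B C D → X * (x₀ * A - B) - (x₀ * C - D) ≡ x₀ * (X * A - C) - (X * B - D)
    regroup = solve-∀

module Words (s : ℕ → ℕ) where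
  open Lists
  open import Data.Nat using (ℕ; zero; suc; _+_; _*_)
  open import Data.Bool using (Bool; true; false)
  open import Data.Fin using (Fin; toℕ)
  open import Data.Maybe using (Maybe; just; nothing)
  open import Data.List using (List; []; _∷_; map; _++_; allFin; length; cartesianProductWith)
  open import Data.List.Properties using (length-map; length-++; length-tabulate)
  open import Data.List.Membership.Propositional using (_∈_)
  open import Data.List.Membership.Propositional.Properties
    using (∈-map⁺; ∈-allFin; ∈-++⁺ˡ; ∈-++⁺ʳ; ∈-cartesianProductWith⁺; ∈-cartesianProductWith⁻)
  open import Data.List.Relation.Unary.Any using (here; there)
  open import Data.List.Relation.Unary.All using ([]; universal)
  open import Data.List.Relation.Unary.All.Properties using () renaming (map⁺ to All-map⁺)
  open import Data.List.Relation.Unary.AllPairs using ([]; _∷_)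
  open import Data.List.Relation.Unary.Unique.Propositional using (Unique)
  open import Data.List.Relation.Unary.Unique.Propositional.Properties
    using (map⁺; ++⁺; cartesianProductWith⁺; allFin⁺)
  open import Data.Product using (Σ; _×_; _,_)
  open import Data.Nat.Properties using (_≟_)
  open import Data.Fin.Properties using (toℕ-injective)
  open import Relation.Nullary.Decidable using (Dec; yes; does; dec-true; dec-false)
  open import Relation.Binary.PropositionalEquality
  open import Relation.Nullary using (¬_)
  open import Function using (_∘_)

  -- A word describes a subgraph of a fan vertex by vertex: each letter records the spoke kept at its
  -- vertex, if any, and whether the path edge to the next vertex is kept.  The status says whether the
  -- current run of linked vertices already has its spoke; the letters are exactly the transitions
  -- under which every run ends up with exactly one spoke.
  data Status : Set where
    unrooted rooted : Status

  data Letter : Status → Status → ℕ → Set where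
    spokeCut  : ∀ {j} → Fin (s j) → Letter unrooted unrooted j
    spokeLink : ∀ {j} → Fin (s j) → Letter unrooted rooted j
    bareLink  : ∀ {q j} → Letter q q j
    bareCut   : ∀ {j} → Letter rooted unrooted j

  data Final : Status → ℕ → Set where
    spokeEnd : ∀ {j} → Fin (s j) → Final unrooted j
    bareEnd  : ∀ {j} → Final rooted j

  data Word : Status → ℕ → ℕ → Set where
    [_] : ∀ {q j} → Final q j → Word q j 0
    _∷_ : ∀ {q q' j r} → Letter q q' j → Word q' (suc j) r → Word q j (suc r)

  spokeOf : ∀ {q q' j} → Letter q q' j → Maybe (Fin (s j))
  spokeOf (spokeCut c) = just c
  spokeOf (spokeLink c) = just c
  spokeOf bareLink = nothing
  spokeOf bareCut = nothing

  linkOf : ∀ {q q' j} → Letter q q' j → Bool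
  linkOf (spokeCut c) = false
  linkOf (spokeLink c) = true
  linkOf bareLink = true
  linkOf bareCut = false

  finalSpoke : ∀ {q j} → Final q j → Maybe (Fin (s j))
  finalSpoke (spokeEnd c) = just c
  finalSpoke bareEnd = nothing

  -- Spokes are compared through toℕ, so that a word can be read against spoke indices whose Fin
  -- type is only propositionally equal to its own.
  selects : ∀ {k} → Maybe (Fin k) → ℕ → Bool
  selects nothing x = false
  selects (just c) x = does (toℕ c ≟ x)

  selects-self : ∀ {k} (c : Fin k) → selects (just c) (toℕ c) ≡ true
  selects-self c = dec-true (toℕ c ≟ toℕ c) refl

  selects-other : ∀ {k} {c c' : Fin k} → c ≢ c' → selects (just c) (toℕ c') ≡ false
  selects-other {c = c} {c'} c≢c' = dec-false (toℕ c ≟ toℕ c') (c≢c' ∘ toℕ-injective)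

  selects⇒≡ : ∀ {k} {c c' : Fin k} → selects (just c) (toℕ c') ≡ true → c ≡ c'
  selects⇒≡ {c = c} {c'} selected = toℕ-injective (witness (toℕ c ≟ toℕ c') selected)
    where
    witness : ∀ {A : Set} (a? : Dec A) → does a? ≡ true → A
    witness (yes a) _ = a

  selects-injective : ∀ {k} {m m' : Maybe (Fin k)} →
                      (∀ (c : Fin k) → selects m (toℕ c) ≡ selects m' (toℕ c)) → m ≡ m'
  selects-injective {m = nothing} {nothing} _ = refl
  selects-injective {m = nothing} {just c'} same with () ← trans (same c') (selects-self c')
  selects-injective {m = just c} {nothing} same with () ← trans (sym (selects-self c)) (same c)
  selects-injective {m = just c} {just c'} same = cong just (sym (selects⇒≡ (trans (sym (same c)) (selects-self c))))

  Letter-determined : ∀ {q q₁ q₂ j} (a : Letter q q₁ j) (b : Letter q q₂ j) →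
    spokeOf a ≡ spokeOf b → linkOf a ≡ linkOf b → _≡_ {A = Σ Status λ q' → Letter q q' j} (q₁ , a) (q₂ , b)
  Letter-determined (spokeCut c) (spokeCut .c) refl _ = refl
  Letter-determined (spokeCut c) (spokeLink _) _ ()
  Letter-determined (spokeCut c) bareLink () _
  Letter-determined (spokeLink c) (spokeCut _) _ ()
  Letter-determined (spokeLink c) (spokeLink .c) refl _ = refl
  Letter-determined (spokeLink c) bareLink () _
  Letter-determined bareLink (spokeCut _) () _
  Letter-determined bareLink (spokeLink _) () _
  Letter-determined {unrooted} bareLink bareLink _ _ = refl
  Letter-determined {rooted} bareLink bareLink _ _ = refl
  Letter-determined bareLink bareCut _ ()
  Letter-determined bareCut bareLink _ ()
  Letter-determined bareCut bareCut _ _ = refl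

  Final-determined : ∀ {q j} (f f' : Final q j) → finalSpoke f ≡ finalSpoke f' → f ≡ f'
  Final-determined (spokeEnd c) (spokeEnd .c) refl = refl
  Final-determined bareEnd bareEnd _ = refl

  linkAt : ∀ {q j r} → Word q j r → ℕ → Bool
  linkAt [ _ ] i = false
  linkAt (a ∷ w) zero = linkOf a
  linkAt (a ∷ w) (suc i) = linkAt w i

  selectsAt : ∀ {q j r} → Word q j r → ℕ → ℕ → Bool
  selectsAt [ f ] zero = selects (finalSpoke f)
  selectsAt [ f ] (suc i) _ = false
  selectsAt (a ∷ w) zero = selects (spokeOf a)
  selectsAt (a ∷ w) (suc i) = selectsAt w i

  finals : ∀ q j → List (Final q j)
  finals unrooted j = map spokeEnd (allFin (s j))
  finals rooted j = bareEnd ∷ []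

  letters : ∀ q q' j → List (Letter q q' j)
  letters unrooted unrooted j = bareLink ∷ map spokeCut (allFin (s j))
  letters unrooted rooted j = map spokeLink (allFin (s j))
  letters rooted unrooted j = bareCut ∷ []
  letters rooted rooted j = bareLink ∷ []

  words : ∀ q j r → List (Word q j r)
  wordsVia : ∀ q q' j r → List (Word q j (suc r))

  words q j zero = map [_] (finals q j)
  words q j (suc r) = wordsVia q unrooted j r ++ wordsVia q rooted j r

  wordsVia q q' j r = cartesianProductWith _∷_ (letters q q' j) (words q' (suc j) r)

  ∈-finals : ∀ {q j} (f : Final q j) → f ∈ finals q j
  ∈-finals (spokeEnd c) = ∈-map⁺ spokeEnd (∈-allFin c)
  ∈-finals bareEnd = here refl

  ∈-letters : ∀ {q q' j} (a : Letter q q' j) → a ∈ letters q q' j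
  ∈-letters (spokeCut c) = there (∈-map⁺ spokeCut (∈-allFin c))
  ∈-letters (spokeLink c) = ∈-map⁺ spokeLink (∈-allFin c)
  ∈-letters {unrooted} bareLink = here refl
  ∈-letters {rooted} bareLink = here refl
  ∈-letters bareCut = here refl

  ∈-words : ∀ {q j r} (w : Word q j r) → w ∈ words q j r
  ∈-words [ f ] = ∈-map⁺ [_] (∈-finals f)
  ∈-words (_∷_ {q' = unrooted} a w) = ∈-++⁺ˡ (∈-cartesianProductWith⁺ _∷_ (∈-letters a) (∈-words w))
  ∈-words (_∷_ {q' = rooted} a w) = ∈-++⁺ʳ _ (∈-cartesianProductWith⁺ _∷_ (∈-letters a) (∈-words w))

  finals-unique : ∀ q j → Unique (finals q j)
  finals-unique unrooted j = map⁺ (λ { refl → refl }) (allFin⁺ (s j))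
  finals-unique rooted j = [] ∷ []

  letters-unique : ∀ q q' j → Unique (letters q q' j)
  letters-unique unrooted unrooted j =
    All-map⁺ (universal (λ _ ()) (allFin (s j))) ∷ map⁺ (λ { refl → refl }) (allFin⁺ (s j))
  letters-unique unrooted rooted j = map⁺ (λ { refl → refl }) (allFin⁺ (s j))
  letters-unique rooted unrooted j = [] ∷ []
  letters-unique rooted rooted j = [] ∷ []

  words-unique : ∀ q j r → Unique (words q j r)
  words-unique q j zero = map⁺ (λ { refl → refl }) (finals-unique q j)
  words-unique q j (suc r) =
    ++⁺ (cartesianProductWith⁺ _∷_ ∷-injective (letters-unique q unrooted j) (words-unique unrooted (suc j) r))
        (cartesianProductWith⁺ _∷_ ∷-injective (letters-unique q rooted j) (words-unique rooted (suc j) r))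
        disjoint
    where
    ∷-injective : ∀ {q'} {a b : Letter q q' j} {u v : Word q' (suc j) r} → a ∷ u ≡ b ∷ v → a ≡ b × u ≡ v
    ∷-injective refl = refl , refl
    disjoint : ∀ {v} → ¬ (v ∈ wordsVia q unrooted j r × v ∈ wordsVia q rooted j r)
    disjoint (v∈ , v∈′)
      with ∈-cartesianProductWith⁻ _∷_ (letters q unrooted j) _ v∈
         | ∈-cartesianProductWith⁻ _∷_ (letters q rooted j) _ v∈′
    ... | _ , _ , _ , _ , refl | _ , _ , _ , _ , ()

  finalCount : Status → ℕ → ℕ
  finalCount unrooted j = s j
  finalCount rooted j = 1

  letterCount : Status → Status → ℕ → ℕ
  letterCount unrooted unrooted j = suc (s j)
  letterCount unrooted rooted j = s j
  letterCount rooted _ j = 1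

  wordCount : Status → ℕ → ℕ → ℕ
  wordCount q j zero = finalCount q j
  wordCount q j (suc r) = letterCount q unrooted j * wordCount unrooted (suc j) r
                        + letterCount q rooted j * wordCount rooted (suc j) r

  length-finals : ∀ q j → length (finals q j) ≡ finalCount q j
  length-finals unrooted j = trans (length-map spokeEnd (allFin (s j))) (length-tabulate _)
  length-finals rooted j = refl

  length-letters : ∀ q q' j → length (letters q q' j) ≡ letterCount q q' j
  length-letters unrooted unrooted j = cong suc (trans (length-map spokeCut (allFin (s j))) (length-tabulate _))
  length-letters unrooted rooted j = trans (length-map spokeLink (allFin (s j))) (length-tabulate _)
  length-letters rooted unrooted j = refl
  length-letters rooted rooted j = refl

  length-words : ∀ q j r → length (words q j r) ≡ wordCount q j r
  length-words q j zero = trans (length-map [_] (finals q j)) (length-finals q j)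
  length-words q j (suc r) = begin
    length (wordsVia q unrooted j r ++ wordsVia q rooted j r)
      ≡⟨ length-++ (wordsVia q unrooted j r) ⟩
    length (wordsVia q unrooted j r) + length (wordsVia q rooted j r)
      ≡⟨ cong₂ _+_ (length-wordsVia unrooted) (length-wordsVia rooted) ⟩
    wordCount q j (suc r) ∎
    where
    open ≡-Reasoning
    length-wordsVia : ∀ q' → length (wordsVia q q' j r) ≡ letterCount q q' j * wordCount q' (suc j) r
    length-wordsVia q' = trans (length-cartesianProductWith _∷_ (letters q q' j) (words q' (suc j) r))
                               (cong₂ _*_ (length-letters q q' j) (length-words q' (suc j) r))

module WordCounts (s : ℕ → ℕ) where
  open import Defs using (K)
  open Words s
  open Continuants
  open import Data.Nat using (zero; suc; _+_; _*_; _<_; s≤s; z≤n)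
  open import Data.Nat.Properties using (+-identityʳ; +-suc; m<m+n)
  import Data.Nat.Tactic.RingSolver as ℕ-Solver
  open import Data.Integer as ℤ using (ℤ; +_)
  open import Data.Integer.Properties using (pos-+; pos-*)
  import Data.Integer.Tactic.RingSolver as ℤ-Solver
  open import Data.Product using (_×_; _,_)
  open import Function using (_∘_)
  open import Relation.Binary.PropositionalEquality

  private
    pos-difference : ∀ {a b} c d → a + b ≡ c * d → + a ≡ + c ℤ.* + d ℤ.- + b
    pos-difference {a} {b} c d a+b≡c*d = begin
      + a                     ≡⟨ cancel (+ a) (+ b) ⟩
      + a ℤ.+ + b ℤ.- + b     ≡⟨ cong (ℤ._- + b) (sym (pos-+ a b)) ⟩
      + (a + b) ℤ.- + b       ≡⟨ cong (λ z → + z ℤ.- + b) a+b≡c*d ⟩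
      + (c * d) ℤ.- + b       ≡⟨ cong (ℤ._- + b) (pos-* c d) ⟩
      + c ℤ.* + d ℤ.- + b     ∎
      where
      open ≡-Reasoning
      cancel : ∀ x y → x ≡ x ℤ.+ y ℤ.- y
      cancel = ℤ-Solver.solve-∀

    first-step : ∀ s N H → (suc s * N + s * H) + H ≡ (s + 1) * (N + H)
    first-step = ℕ-Solver.solve-∀

    inner-step : ∀ s N H → ((suc s * N + s * H) + (1 * N + 1 * H)) + H ≡ (s + 2) * (N + H)
    inner-step = ℕ-Solver.solve-∀

  module _ (n : ℕ) (w : ℕ → ℕ)
           (first : s 0 + 1 ≡ w 0)
           (inner : ∀ j → 0 < j → j < n → s j + 2 ≡ w j)
           (last : s n + 1 ≡ w n) where

    private
      x : ℕ → ℤ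
      x i = + w i

      N H : ℕ → ℕ → ℕ
      N = wordCount unrooted
      H = wordCount rooted

    suffixCount : ∀ r j → 0 < j → j + r ≡ n →
      (+ (N j r + H j r) ≡ K (suc r) (λ i → x (j + i))) × (+ H j r ≡ K r (λ i → x (suc j + i)))
    suffixCount zero j _ j+0≡n = cong +_ lastVertex , refl
      where
      j≡n = trans (sym (+-identityʳ j)) j+0≡n
      lastVertex : s j + 1 ≡ w (j + 0)
      lastVertex = trans (cong (λ k → s k + 1) j≡n) (trans last (cong w (sym j+0≡n)))
    suffixCount (suc r) j 0<j j+r+1≡n with suffixCount r (suc j) (s≤s z≤n) (trans (sym (+-suc j r)) j+r+1≡n)
    ... | IH-total , IH-rooted = total , trans (cong +_ (ones (N (suc j) r) (H (suc j) r))) IH-total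
      where
      open ≡-Reasoning
      ones : ∀ a b → 1 * a + 1 * b ≡ a + b
      ones = ℕ-Solver.solve-∀
      j<n : j < n
      j<n = subst (j <_) j+r+1≡n (m<m+n j (s≤s z≤n))
      recurrence : (N j (suc r) + H j (suc r)) + H (suc j) r ≡ w j * (N (suc j) r + H (suc j) r)
      recurrence = trans (inner-step (s j) (N (suc j) r) (H (suc j) r))
                         (cong (_* (N (suc j) r + H (suc j) r)) (inner j 0<j j<n))
      total : + (N j (suc r) + H j (suc r)) ≡ K (suc (suc r)) (λ i → x (j + i))
      total = begin
        + (N j (suc r) + H j (suc r))
          ≡⟨ pos-difference (w j) (N (suc j) r + H (suc j) r) recurrence ⟩
        x j ℤ.* + (N (suc j) r + H (suc j) r) ℤ.- + H (suc j) r
          ≡⟨ cong₂ (λ u v → x j ℤ.* u ℤ.- v) IH-total IH-rooted ⟩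
        x j ℤ.* K (suc r) (λ i → x (suc j + i)) ℤ.- K r (λ i → x (suc (suc j) + i))
          ≡⟨ cong₂ ℤ._-_ (cong₂ ℤ._*_ (cong x (sym (+-identityʳ j)))
                                      (K-cong (suc r) λ i → cong x (sym (+-suc j i))))
                         (K-cong r λ i → cong x (sym (trans (+-suc j (suc i)) (cong suc (+-suc j i))))) ⟩
        x (j + 0) ℤ.* K (suc r) (λ i → x (j + suc i)) ℤ.- K r (λ i → x (j + suc (suc i)))
          ≡⟨ sym (K-unfoldˡ r (λ i → x (j + i))) ⟩
        K (suc (suc r)) (λ i → x (j + i)) ∎

    wordCount-continuant : 0 < n → + N 0 n ≡ K (suc n) x
    wordCount-continuant (s≤s {n = r} z≤n)
      with suffixCount r 1 (s≤s z≤n) refl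
    ... | IH-total , IH-rooted = begin
      + N 0 (suc r)
        ≡⟨ pos-difference (w 0) (N 1 r + H 1 r) recurrence ⟩
      x 0 ℤ.* + (N 1 r + H 1 r) ℤ.- + H 1 r
        ≡⟨ cong₂ (λ u v → x 0 ℤ.* u ℤ.- v) IH-total IH-rooted ⟩
      x 0 ℤ.* K (suc r) (x ∘ suc) ℤ.- K r (x ∘ suc ∘ suc)
        ≡⟨ sym (K-unfoldˡ r x) ⟩
      K (suc (suc r)) x ∎
      where
      open ≡-Reasoning
      recurrence : N 0 (suc r) + H 1 r ≡ w 0 * (N 1 r + H 1 r)
      recurrence = trans (first-step (s 0) (N 1 r) (H 1 r)) (cong (_* (N 1 r + H 1 r)) first)

module Fans where
  open import Defs
  open Multigraphs
  open import Data.Nat using (ℕ; zero; suc; _+_; _∸_; _≤_; _<_; z≤n; s≤s; _≤?_)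
  open import Data.Nat.Properties
  open import Data.Bool using (Bool; true; false)
  open import Data.Bool.Properties using (¬-not)
  open import Data.Empty using (⊥; ⊥-elim)
  open import Data.Fin using (Fin; toℕ)
  open import Data.Fin.Properties using (any?) renaming (_≟_ to _≟ᶠ_)
  open import Data.Fin.Subset using (_∈_; _∉_; _-_)
  open import Data.Fin.Subset.Properties using (x∈p∧x≢y⇒x∈p-y)
  open import Data.Maybe using (Maybe; just; nothing)
  open import Data.List using (length)
  open import Data.Product using (Σ; _×_; _,_; proj₁; proj₂)
  open import Data.Sum using (_⊎_; inj₁; inj₂)
  open import Data.Vec using (lookup)
  open import Data.Vec.Properties using ([]=⇒lookup; lookup⇒[]=)
  open import Function using (_∘_)
  open import Relation.Binary.PropositionalEquality
  open import Relation.Nullary using (¬_; Dec; yes; no)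

  -- Path vertices vertex 0 … vertex n, path edges pathEdge k from vertex k to vertex (suc k), and
  -- spokes k parallel spokes from vertex k to the hub; the fields say nothing about positions beyond n.
  record Fan {V : Set} (G : Multigraph V) : Set where
    field
      hub : V
      n : ℕ
      vertex : ℕ → V
      spokes : ℕ → ℕ
      pathEdge : ℕ → Fin (length G)
      spokeEdge : (k : ℕ) → Fin (spokes k) → Fin (length G)
      vertex-injective : ∀ {k l} → k ≤ n → l ≤ n → vertex k ≡ vertex l → k ≡ l
      vertex≢hub : ∀ {k} → k ≤ n → vertex k ≢ hub
      pathEdge-ends : ∀ {k} → k < n → ends G (pathEdge k) ≡ (vertex k , vertex (suc k))
      spokeEdge-ends : ∀ {k} (c : Fin (spokes k)) → k ≤ n → ends G (spokeEdge k c) ≡ (vertex k , hub)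
      spokeEdge-injective : ∀ {k c c'} → k ≤ n → spokeEdge k c ≡ spokeEdge k c' → c ≡ c'

  module _ {V : Set} {G : Multigraph V} (F : Fan G) where
    open Fan F

    data FanEdge (e : Fin (length G)) : Set where
      path  : ∀ k → k < n → e ≡ pathEdge k → FanEdge e
      spoke : ∀ k (c : Fin (spokes k)) → k ≤ n → e ≡ spokeEdge k c → FanEdge e
      away  : (∀ k → k ≤ n → proj₁ (ends G e) ≢ vertex k × proj₂ (ends G e) ≢ vertex k) → FanEdge e

  module FanWords {V : Set} {G : Multigraph V} (F : Fan G) where
    open Fan F public
    open Words spokes public

    module _ (S : EdgeSubset G) where

      linked : ℕ → Bool
      linked k = lookup S (pathEdge k)

      selected : (k : ℕ) → Fin (spokes k) → Bool
      selected k c = lookup S (spokeEdge k c)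

      SpokesAt : (j : ℕ) → Maybe (Fin (spokes j)) → Set
      SpokesAt j m = ∀ c → selected j c ≡ selects m (toℕ c)

      Observes : ∀ {q q' j} → Letter q q' j → Set
      Observes {j = j} a = SpokesAt j (spokeOf a) × linked j ≡ linkOf a

      Realises : ∀ {q j r} → Word q j r → Set
      Realises {j = j} [ f ] = SpokesAt j (finalSpoke f)
      Realises (a ∷ w) = Observes a × Realises w

      Realises-injective : ∀ {q j r} (w w' : Word q j r) → Realises w → Realises w' → w ≡ w'
      Realises-injective [ f ] [ f' ] spokes-f spokes-f' =
        cong [_] (Final-determined f f' (selects-injective λ c → trans (sym (spokes-f c)) (spokes-f' c)))
      Realises-injective (a ∷ w) (b ∷ w') ((spokes-a , link-a) , realises-w) ((spokes-b , link-b) , realises-w')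
        with Letter-determined a b (selects-injective λ c → trans (sym (spokes-a c)) (spokes-b c)) (trans (sym link-a) link-b)
      ... | refl = cong (a ∷_) (Realises-injective w w' realises-w realises-w')

      Agrees : ∀ {q j r} → Word q j r → Set
      Agrees {j = j} {r} w =
        (∀ k → j ≤ k → k < j + r → linked k ≡ linkAt w (k ∸ j)) ×
        (∀ k c → j ≤ k → k ≤ j + r → selected k c ≡ selectsAt w (k ∸ j) (toℕ c))

      private
        ∸-later : ∀ {j k} → j < k → k ∸ j ≡ suc (k ∸ suc j)
        ∸-later {k = suc k} (s≤s j≤k) = +-∸-assoc 1 j≤k

      Agrees-[]⁻ : ∀ {q j} {f : Final q j} → Agrees [ f ] → SpokesAt j (finalSpoke f)
      Agrees-[]⁻ {j = j} {f} (_ , selected-bits) c =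
        trans (selected-bits j c ≤-refl (m≤m+n j 0)) (cong (λ i → selectsAt [ f ] i (toℕ c)) (n∸n≡0 j))

      Agrees-[]⁺ : ∀ {q j} {f : Final q j} → SpokesAt j (finalSpoke f) → Agrees [ f ]
      Agrees-[]⁺ {j = j} {f} spokes-j =
        (λ k j≤k k<j+0 → ⊥-elim (<⇒≱ k<j+0 (subst (_≤ k) (sym (+-identityʳ j)) j≤k))) ,
        (λ k c j≤k k≤j+0 → at-j k c (≤-antisym j≤k (subst (k ≤_) (+-identityʳ j) k≤j+0)))
        where
        at-j : ∀ k c → j ≡ k → selected k c ≡ selectsAt [ f ] (k ∸ j) (toℕ c)
        at-j k c refl = trans (spokes-j c) (cong (λ i → selectsAt [ f ] i (toℕ c)) (sym (n∸n≡0 j)))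

      Agrees-∷⁻ : ∀ {q q' j r} {a : Letter q q' j} {w : Word q' (suc j) r} → Agrees (a ∷ w) → Observes a × Agrees w
      Agrees-∷⁻ {j = j} {r} {a} {w} (linked-bits , selected-bits) =
        ( (λ c → trans (selected-bits j c ≤-refl (m≤m+n j _)) (cong (λ i → selectsAt (a ∷ w) i (toℕ c)) (n∸n≡0 j)))
        , trans (linked-bits j ≤-refl (m<m+n j (s≤s z≤n))) (cong (linkAt (a ∷ w)) (n∸n≡0 j)) )
        , ( (λ k j<k k<end → trans (linked-bits k (<⇒≤ j<k) (subst (k <_) (sym (+-suc j r)) k<end))
                                   (cong (linkAt (a ∷ w)) (∸-later j<k)))
          , (λ k c j<k k≤end → trans (selected-bits k c (<⇒≤ j<k) (subst (k ≤_) (sym (+-suc j r)) k≤end))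
                                     (cong (λ i → selectsAt (a ∷ w) i (toℕ c)) (∸-later j<k))) )

      Agrees-∷⁺ : ∀ {q q' j r} {a : Letter q q' j} {w : Word q' (suc j) r} → Observes a → Agrees w → Agrees (a ∷ w)
      Agrees-∷⁺ {j = j} {r} {a} {w} (spokes-j , link-j) (linked-bits , selected-bits) =
        (λ k j≤k k<end → at-or-after k j≤k
           (λ { refl → trans link-j (cong (linkAt (a ∷ w)) (sym (n∸n≡0 j))) })
           (λ j<k → trans (linked-bits k j<k (subst (k <_) (+-suc j r) k<end))
                          (cong (linkAt (a ∷ w)) (sym (∸-later j<k))))) ,
        (λ k c j≤k k≤end → at-or-after k j≤k
           (λ { refl → trans (spokes-j c) (cong (λ i → selectsAt (a ∷ w) i (toℕ c)) (sym (n∸n≡0 j))) })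
           (λ j<k → trans (selected-bits k c j<k (subst (k ≤_) (+-suc j r) k≤end))
                          (cong (λ i → selectsAt (a ∷ w) i (toℕ c)) (sym (∸-later j<k)))))
        where
        at-or-after : ∀ {P : Set} k → j ≤ k → (j ≡ k → P) → (j < k → P) → P
        at-or-after k j≤k at after with m≤n⇒m<n∨m≡n j≤k
        ... | inj₁ j<k = after j<k
        ... | inj₂ j≡k = at j≡k

      Agrees⇒Realises : ∀ {q j r} (w : Word q j r) → Agrees w → Realises w
      Agrees⇒Realises [ f ] = Agrees-[]⁻
      Agrees⇒Realises (a ∷ w) agrees with Agrees-∷⁻ {a = a} {w} agrees
      ... | observes , agrees-w = observes , Agrees⇒Realises w agrees-w

      Realises⇒Agrees : ∀ {q j r} (w : Word q j r) → Realises w → Agrees w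
      Realises⇒Agrees [ f ] = Agrees-[]⁺
      Realises⇒Agrees (a ∷ w) (observes , realises) = Agrees-∷⁺ {a = a} {w} observes (Realises⇒Agrees w realises)

  module FanTheory {V : Set} {G : Multigraph V} (F : Fan G) (classify : ∀ e → FanEdge F e) where
    open FanWords F

    spokeEdge-position : ∀ {k k' c c'} → k ≤ n → k' ≤ n → spokeEdge k c ≡ spokeEdge k' c' → k ≡ k'
    spokeEdge-position {c = c} {c'} k≤n k'≤n eq =
      vertex-injective k≤n k'≤n
        (cong proj₁ (trans (sym (spokeEdge-ends c k≤n)) (trans (cong (ends G) eq) (spokeEdge-ends c' k'≤n))))

    pathEdge≢spokeEdge : ∀ {k k' c} → k < n → k' ≤ n → pathEdge k ≢ spokeEdge k' c
    pathEdge≢spokeEdge {c = c} k<n k'≤n eq =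
      vertex≢hub k<n (cong proj₂ (trans (sym (pathEdge-ends k<n)) (trans (cong (ends G) eq) (spokeEdge-ends c k'≤n))))

    walk : ∀ {T x y} → x ≤ y → y ≤ n → (∀ k → x ≤ k → k < y → pathEdge k ∈ T) →
           Reach G T (vertex x) (vertex y)
    walk {y = zero} z≤n _ _ = here
    walk {x = x} {suc y} x≤y+1 y+1≤n linked with m≤n⇒m<n∨m≡n x≤y+1
    ... | inj₂ refl = here
    ... | inj₁ (s≤s x≤y) =
      Reach-trans G (walk x≤y (<⇒≤ y+1≤n) λ k x≤k k<y → linked k x≤k (m<n⇒m<1+n k<y))
                    (edge⇒Reach G (pathEdge y) (linked y x≤y ≤-refl) (pathEdge-ends y+1≤n))

    InBlock : ℕ → ℕ → V → Set
    InBlock lo hi v = Σ ℕ λ k → lo ≤ k × k ≤ hi × vertex k ≡ v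

    record Isolated (T : EdgeSubset G) (lo hi : ℕ) : Set where
      field
        hi≤n : hi ≤ n
        cut-before : ∀ k → k < n → pathEdge k ∈ T → suc k ≢ lo
        cut-after : ∀ k → k < n → pathEdge k ∈ T → k ≢ hi
        spokeless : ∀ k c → lo ≤ k → k ≤ hi → spokeEdge k c ∉ T

    Isolated⇒EdgeClosed : ∀ {T lo hi} → Isolated T lo hi → EdgeClosed G T (InBlock lo hi)
    Isolated⇒EdgeClosed {T} {lo} {hi} iso e e∈T with classify e
    ... | path k k<n refl = subst (ClosedAlong (InBlock lo hi)) (sym (pathEdge-ends k<n)) (forward , backward)
      where
      open Isolated iso
      forward : InBlock lo hi (vertex k) → InBlock lo hi (vertex (suc k))
      forward (k' , lo≤k' , k'≤hi , eq) with vertex-injective (≤-trans k'≤hi hi≤n) (<⇒≤ k<n) eq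
      ... | refl = suc k , m≤n⇒m≤1+n lo≤k' , ≤∧≢⇒< k'≤hi (cut-after k k<n e∈T) , refl
      backward : InBlock lo hi (vertex (suc k)) → InBlock lo hi (vertex k)
      backward (k' , lo≤k' , k'≤hi , eq) with vertex-injective (≤-trans k'≤hi hi≤n) k<n eq
      ... | refl = k , ≤-pred (≤∧≢⇒< lo≤k' (cut-before k k<n e∈T ∘ sym)) , <⇒≤ k'≤hi , refl
    ... | spoke k c k≤n refl = subst (ClosedAlong (InBlock lo hi)) (sym (spokeEdge-ends c k≤n)) (forward , backward)
      where
      open Isolated iso
      forward : InBlock lo hi (vertex k) → InBlock lo hi hub
      forward (k' , lo≤k' , k'≤hi , eq) with vertex-injective (≤-trans k'≤hi hi≤n) k≤n eq
      ... | refl = ⊥-elim (spokeless k c lo≤k' k'≤hi e∈T)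
      backward : InBlock lo hi hub → InBlock lo hi (vertex k)
      backward (k' , _ , k'≤hi , eq) = ⊥-elim (vertex≢hub (≤-trans k'≤hi hi≤n) eq)
    ... | away apart = forward , backward
      where
      open Isolated iso
      forward : InBlock lo hi (proj₁ (ends G e)) → InBlock lo hi (proj₂ (ends G e))
      forward (k , _ , k≤hi , eq) = ⊥-elim (proj₁ (apart k (≤-trans k≤hi hi≤n)) (sym eq))
      backward : InBlock lo hi (proj₂ (ends G e)) → InBlock lo hi (proj₁ (ends G e))
      backward (k , _ , k≤hi , eq) = ⊥-elim (proj₂ (apart k (≤-trans k≤hi hi≤n)) (sym eq))

    Isolated⇒InBlock : ∀ {T lo hi x v} → Isolated T lo hi → lo ≤ x → x ≤ hi → Reach G T (vertex x) v →
                       InBlock lo hi v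
    Isolated⇒InBlock {x = x} iso lo≤x x≤hi reach =
      Reach-preserves G (Isolated⇒EdgeClosed iso) reach (x , lo≤x , x≤hi , refl)

    Isolated⇒¬Reach-hub : ∀ {T lo hi x} → Isolated T lo hi → lo ≤ x → x ≤ hi → ¬ Reach G T (vertex x) hub
    Isolated⇒¬Reach-hub iso lo≤x x≤hi reach with Isolated⇒InBlock iso lo≤x x≤hi reach
    ... | k , _ , k≤hi , vk≡hub = vertex≢hub (≤-trans k≤hi (Isolated.hi≤n iso)) vk≡hub

    Isolated⇒¬Reach-outside : ∀ {T lo hi x y} → Isolated T lo hi → lo ≤ x → x ≤ hi → y ≤ n →
                              y < lo ⊎ hi < y → ¬ Reach G T (vertex x) (vertex y)
    Isolated⇒¬Reach-outside iso lo≤x x≤hi y≤n outside reach with Isolated⇒InBlock iso lo≤x x≤hi reach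
    ... | k , lo≤k , k≤hi , vk≡vy with vertex-injective (≤-trans k≤hi (Isolated.hi≤n iso)) y≤n vk≡vy
    ...   | refl with outside
    ...     | inj₁ k<lo = <⇒≱ k<lo lo≤k
    ...     | inj₂ hi<k = <⇒≱ hi<k k≤hi

    module FromSpanningTree (S : EdgeSubset G) (tree : IsSpanningTree G S) where

      private
        connected = proj₁ tree
        acyclic = proj₂ tree

      selected-unique : ∀ {k c c'} → k ≤ n → selected S k c ≡ true → selected S k c' ≡ true → c ≡ c'
      selected-unique {k} {c} {c'} k≤n c-selected c'-selected with c ≟ᶠ c'
      ... | yes c≡c' = c≡c'
      ... | no c≢c' = ⊥-elim (Acyclic⇒¬Reach G acyclic (lookup⇒[]= _ S c-selected) (spokeEdge-ends c k≤n)
                        (edge⇒Reach G (spokeEdge k c')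
                           (x∈p∧x≢y⇒x∈p-y (lookup⇒[]= _ S c'-selected) (c≢c' ∘ sym ∘ spokeEdge-injective k≤n))
                           (spokeEdge-ends c' k≤n)))

      rooted-twice : ∀ {a j c c'} → a < j → j ≤ n → selected S a c ≡ true → selected S j c' ≡ true →
                     (∀ k → a ≤ k → k < j → linked S k ≡ true) → ⊥
      rooted-twice {a} {j} {c} {c'} a<j j≤n a-selected j-selected linked-a-j =
        Acyclic⇒¬Reach G acyclic (lookup⇒[]= _ S j-selected) (spokeEdge-ends c' j≤n)
          (Reach-trans G (Reach-sym G (walk (<⇒≤ a<j) j≤n path∈S-e))
                         (edge⇒Reach G (spokeEdge a c) a∈S-e (spokeEdge-ends c a≤n)))
        where
        a≤n = ≤-trans (<⇒≤ a<j) j≤n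
        path∈S-e : ∀ k → a ≤ k → k < j → pathEdge k ∈ S - spokeEdge j c'
        path∈S-e k a≤k k<j = x∈p∧x≢y⇒x∈p-y (lookup⇒[]= _ S (linked-a-j k a≤k k<j))
                                           (pathEdge≢spokeEdge (<-≤-trans k<j j≤n) j≤n)
        a∈S-e : spokeEdge a c ∈ S - spokeEdge j c'
        a∈S-e = x∈p∧x≢y⇒x∈p-y (lookup⇒[]= _ S a-selected) (<⇒≢ a<j ∘ spokeEdge-position a≤n j≤n)

      spokeChoice : ∀ j → j ≤ n → Σ (Maybe (Fin (spokes j))) (SpokesAt S j)
      spokeChoice j j≤n with any? (λ c → selected S j c Data.Bool.≟ true)
      ... | yes (c , c-selected) = just c , agree
        where
        agree : ∀ c' → selected S j c' ≡ selects (just c) (toℕ c')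
        agree c' with selected S j c' in c'-selected
        ... | true = subst (λ x → true ≡ selects (just c) (toℕ x)) (selected-unique j≤n c-selected c'-selected)
                           (sym (selects-self c))
        ... | false = sym (selects-other {c = c} {c'}
                            λ { refl → lookup≡false⇒∉ c'-selected (lookup⇒[]= _ S c-selected) })
      ... | no none-selected = nothing , λ c → ¬-not (λ c-selected → none-selected (c , c-selected))

      Rooted : Status → ℕ → ℕ → Set
      Rooted unrooted b j = ∀ k c → b ≤ k → k < j → selected S k c ≡ false
      Rooted rooted b j = Σ ℕ λ a → Σ (Fin (spokes a)) λ c → b ≤ a × a < j × selected S a c ≡ true

      record Prefix (q : Status) (j : ℕ) : Set where
        field
          start : ℕ
          start≤j : start ≤ j
          cut-before : ∀ k → suc k ≡ start → linked S k ≡ false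
          linked-since : ∀ k → start ≤ k → k < j → linked S k ≡ true
          rootedness : Rooted q start j

      unrooted-isolated : ∀ {j} → Prefix unrooted j → j ≤ n → SpokesAt S j nothing →
                          (j < n → linked S j ≡ false) → ⊥
      unrooted-isolated {j} prefix j≤n spokeless-j cut-after-j =
        Isolated⇒¬Reach-hub isolated ≤-refl start≤j (connected (vertex start) hub)
        where
        open Prefix prefix
        spokeless : ∀ k c → start ≤ k → k ≤ j → selected S k c ≡ false
        spokeless k c start≤k k≤j with m≤n⇒m<n∨m≡n k≤j
        ... | inj₁ k<j = rootedness k c start≤k k<j
        ... | inj₂ refl = spokeless-j c
        isolated : Isolated S start j
        isolated = record
          { hi≤n = j≤n
          ; cut-before = λ k _ k∈S sk≡start → lookup≡false⇒∉ (cut-before k sk≡start) k∈S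
          ; cut-after = λ { k k<n k∈S refl → lookup≡false⇒∉ (cut-after-j k<n) k∈S }
          ; spokeless = λ k c start≤k k≤j → lookup≡false⇒∉ (spokeless k c start≤k k≤j)
          }

      rooted-again : ∀ {j c} → Prefix rooted j → j ≤ n → SpokesAt S j (just c) → ⊥
      rooted-again {j} {c} prefix j≤n spokes-j = earlier-root rootedness
        where
        open Prefix prefix
        earlier-root : Rooted rooted start j → ⊥
        earlier-root (a , _ , start≤a , a<j , a-selected) =
          rooted-twice a<j j≤n a-selected (trans (spokes-j c) (selects-self c))
                       (λ k a≤k k<j → linked-since k (≤-trans start≤a a≤k) k<j)

      fresh : ∀ {j} → linked S j ≡ false → Prefix unrooted (suc j)
      fresh {j} cut = record
        { start = suc j
        ; start≤j = ≤-refl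
        ; cut-before = λ { k refl → cut }
        ; linked-since = λ k sj≤k k<sj → ⊥-elim (<⇒≱ k<sj sj≤k)
        ; rootedness = λ k c sj≤k k<sj → ⊥-elim (<⇒≱ k<sj sj≤k)
        }

      continue : ∀ {q q' j} (prefix : Prefix q j) → linked S j ≡ true →
                 Rooted q' (Prefix.start prefix) (suc j) → Prefix q' (suc j)
      continue {j = j} prefix link rooted′ = record
        { start = start
        ; start≤j = m≤n⇒m≤1+n start≤j
        ; cut-before = cut-before
        ; linked-since = linked-since′
        ; rootedness = rooted′
        }
        where
        open Prefix prefix
        linked-since′ : ∀ k → start ≤ k → k < suc j → linked S k ≡ true
        linked-since′ k start≤k k<sj with m≤n⇒m<n∨m≡n (≤-pred k<sj)
        ... | inj₁ k<j = linked-since k start≤k k<j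
        ... | inj₂ refl = link

      still-unrooted : ∀ {b j} → Rooted unrooted b j → SpokesAt S j nothing → Rooted unrooted b (suc j)
      still-unrooted rooted′ spokeless-j k c b≤k k<sj with m≤n⇒m<n∨m≡n (≤-pred k<sj)
      ... | inj₁ k<j = rooted′ k c b≤k k<j
      ... | inj₂ refl = spokeless-j c

      step : ∀ {q j} → Prefix q j → j < n →
             Σ Status λ q' → Σ (Letter q q' j) λ a → Observes S a × Prefix q' (suc j)
      step {q} {j} prefix j<n with spokeChoice j (<⇒≤ j<n) | linked S j in link
      step {unrooted} prefix j<n | just c , spokes-j | false =
        unrooted , spokeCut c , (spokes-j , refl) , fresh link
      step {unrooted} {j} prefix j<n | just c , spokes-j | true =
        rooted , spokeLink c , (spokes-j , refl) ,
        continue prefix link (j , c , Prefix.start≤j prefix , ≤-refl , trans (spokes-j c) (selects-self c))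
      step {unrooted} prefix j<n | nothing , spokes-j | true =
        unrooted , bareLink , (spokes-j , refl) , continue prefix link (still-unrooted (Prefix.rootedness prefix) spokes-j)
      step {unrooted} prefix j<n | nothing , spokes-j | false =
        ⊥-elim (unrooted-isolated prefix (<⇒≤ j<n) spokes-j (λ _ → link))
      step {rooted} prefix j<n | nothing , spokes-j | false =
        unrooted , bareCut , (spokes-j , refl) , fresh link
      step {rooted} prefix j<n | nothing , spokes-j | true =
        rooted , bareLink , (spokes-j , refl) , continue prefix link (still-rooted (Prefix.rootedness prefix))
        where
        still-rooted : ∀ {b j} → Rooted rooted b j → Rooted rooted b (suc j)
        still-rooted (a , c , b≤a , a<j , a-selected) = a , c , b≤a , m≤n⇒m≤1+n a<j , a-selected
      step {rooted} prefix j<n | just c , spokes-j | _ = ⊥-elim (rooted-again {c = c} prefix (<⇒≤ j<n) spokes-j)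

      finish : ∀ {q} → Prefix q n → Σ (Final q n) λ f → SpokesAt S n (finalSpoke f)
      finish {q} prefix with q | spokeChoice n ≤-refl
      ... | unrooted | just c , spokes-n = spokeEnd c , spokes-n
      ... | unrooted | nothing , spokes-n = ⊥-elim (unrooted-isolated prefix ≤-refl spokes-n (⊥-elim ∘ <-irrefl refl))
      ... | rooted | nothing , spokes-n = bareEnd , spokes-n
      ... | rooted | just c , spokes-n = ⊥-elim (rooted-again {c = c} prefix ≤-refl spokes-n)

      word-from : ∀ r {q j} → j + r ≡ n → Prefix q j → Σ (Word q j r) (Realises S)
      word-from zero {j = j} j+0≡n prefix with trans (sym (+-identityʳ j)) j+0≡n
      ... | refl = let f , spokes-n = finish prefix in [ f ] , spokes-n
      word-from (suc r) {j = j} j+r+1≡n prefix =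
        let _ , a , observes , prefix′ = step prefix (subst (j <_) j+r+1≡n (m<m+n j (s≤s z≤n)))
            w , realises = word-from r (trans (sym (+-suc j r)) j+r+1≡n) prefix′
        in a ∷ w , observes , realises

      spanningTree⇒Word : Σ (Word unrooted 0 n) (Realises S)
      spanningTree⇒Word = word-from n refl record
        { start = 0 ; start≤j = z≤n ; cut-before = λ _ () ; linked-since = λ _ _ () ; rootedness = λ _ _ _ () }

    module FromRealisation (S : EdgeSubset G) where

      record Block (x : ℕ) : Set where
        field
          start end root : ℕ
          rootSpoke : Fin (spokes root)
          start≤x : start ≤ x
          x≤end : x ≤ end
          end≤n : end ≤ n
          start≤root : start ≤ root
          root≤end : root ≤ end
          cut-before : ∀ k → suc k ≡ start → linked S k ≡ false
          cut-after : end < n → linked S end ≡ false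
          linked-inside : ∀ k → start ≤ k → k < end → linked S k ≡ true
          root-selected : selected S root rootSpoke ≡ true
          root-unique : ∀ k c → start ≤ k → k ≤ end → selected S k c ≡ true →
                        spokeEdge k c ≡ spokeEdge root rootSpoke

      Rest : Status → ℕ → ℕ → Set
      Rest unrooted j t = Σ ℕ λ a → Σ (Fin (spokes a)) λ c → j ≤ a × a ≤ t × selected S a c ≡ true ×
                          (∀ k c' → j ≤ k → k ≤ t → selected S k c' ≡ true → spokeEdge k c' ≡ spokeEdge a c)
      Rest rooted j t = ∀ k c → j ≤ k → k ≤ t → selected S k c ≡ false

      record Suffix (q : Status) (j : ℕ) : Set where
        field
          end : ℕ
          j≤end : j ≤ end
          end≤n : end ≤ n
          cut-after : end < n → linked S end ≡ false
          linked-until : ∀ k → j ≤ k → k < end → linked S k ≡ true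
          rest : Rest q j end
          later : ∀ x → end < x → x ≤ n → Block x

      blocksFrom : ∀ {b} → (∀ k → suc k ≡ b → linked S k ≡ false) → Suffix unrooted b →
                   ∀ x → b ≤ x → x ≤ n → Block x
      blocksFrom {b} cut suffix x b≤x x≤n with x ≤? Suffix.end suffix | Suffix.rest suffix
      ... | no x≰end | _ = Suffix.later suffix x (≰⇒> x≰end) x≤n
      ... | yes x≤end | a , c , b≤a , a≤end , a-selected , unique = record
        { start = b ; end = end ; root = a ; rootSpoke = c
        ; start≤x = b≤x ; x≤end = x≤end ; end≤n = end≤n ; start≤root = b≤a ; root≤end = a≤end
        ; cut-before = cut ; cut-after = cut-after ; linked-inside = linked-until
        ; root-selected = a-selected ; root-unique = unique
        }
        where open Suffix suffix

      nothing-later : ∀ {j} → Rest rooted (suc j) j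
      nothing-later k c sj≤k k≤j = ⊥-elim (<⇒≱ sj≤k k≤j)

      rooted-at : ∀ {j t c} → j ≤ t → SpokesAt S j (just c) → Rest rooted (suc j) t → Rest unrooted j t
      rooted-at {j} {c = c} j≤t spokes-j rest =
        j , c , ≤-refl , j≤t , trans (spokes-j c) (selects-self c) , unique
        where
        unique : ∀ k c' → j ≤ k → k ≤ _ → selected S k c' ≡ true → spokeEdge k c' ≡ spokeEdge j c
        unique k c' j≤k k≤t c'-selected with m≤n⇒m<n∨m≡n j≤k
        ... | inj₁ j<k with () ← trans (sym c'-selected) (rest k c' j<k k≤t)
        ... | inj₂ refl = cong (spokeEdge k) (sym (selects⇒≡ (trans (sym (spokes-j c')) c'-selected)))

      bare-rooted : ∀ {j t} → SpokesAt S j nothing → Rest rooted (suc j) t → Rest rooted j t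
      bare-rooted spokes-j rest k c j≤k k≤t with m≤n⇒m<n∨m≡n j≤k
      ... | inj₁ j<k = rest k c j<k k≤t
      ... | inj₂ refl = spokes-j c

      bare-unrooted : ∀ {j t} → SpokesAt S j nothing → Rest unrooted (suc j) t → Rest unrooted j t
      bare-unrooted {j} spokes-j (a , c , sj≤a , a≤t , a-selected , unique) =
        a , c , <⇒≤ sj≤a , a≤t , a-selected , unique′
        where
        unique′ : ∀ k c' → j ≤ k → k ≤ _ → selected S k c' ≡ true → spokeEdge k c' ≡ spokeEdge a c
        unique′ k c' j≤k k≤t c'-selected with m≤n⇒m<n∨m≡n j≤k
        ... | inj₁ j<k = unique k c' j<k k≤t c'-selected
        ... | inj₂ refl with () ← trans (sym c'-selected) (spokes-j c')

      closing : ∀ {q j} → j ≤ n → (j < n → linked S j ≡ false) → Rest q j j →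
                (∀ x → j < x → x ≤ n → Block x) → Suffix q j
      closing {j = j} j≤n cut rest later = record
        { end = j ; j≤end = ≤-refl ; end≤n = j≤n ; cut-after = cut
        ; linked-until = λ k j≤k k<j → ⊥-elim (<⇒≱ k<j j≤k) ; rest = rest ; later = later }

      extending : ∀ {q q' j} (suffix : Suffix q' (suc j)) → linked S j ≡ true →
                  Rest q j (Suffix.end suffix) → Suffix q j
      extending {j = j} suffix link rest′ = record
        { end = end ; j≤end = <⇒≤ j≤end ; end≤n = end≤n ; cut-after = cut-after
        ; linked-until = linked-until′ ; rest = rest′ ; later = later }
        where
        open Suffix suffix
        linked-until′ : ∀ k → j ≤ k → k < end → linked S k ≡ true
        linked-until′ k j≤k k<end with m≤n⇒m<n∨m≡n j≤k
        ... | inj₁ j<k = linked-until k j<k k<end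
        ... | inj₂ refl = link

      suffix : ∀ {q j r} (w : Word q j r) → j + r ≡ n → Realises S w → Suffix q j
      suffix {j = j} [ f ] j+0≡n spokes-j with trans (sym (+-identityʳ j)) j+0≡n | f
      ... | refl | spokeEnd c = closing ≤-refl (⊥-elim ∘ <-irrefl refl) (rooted-at {c = c} ≤-refl spokes-j nothing-later)
                                         (λ x j<x x≤j → ⊥-elim (<⇒≱ j<x x≤j))
      ... | refl | bareEnd = closing ≤-refl (⊥-elim ∘ <-irrefl refl) (bare-rooted spokes-j nothing-later)
                                     (λ x j<x x≤j → ⊥-elim (<⇒≱ j<x x≤j))
      suffix {j = j} {suc r} (a ∷ w) j+r+1≡n ((spokes-j , link) , realises)
        with a | suffix w (trans (sym (+-suc j r)) j+r+1≡n) realises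
      ... | spokeCut c | next = closing j≤n (λ _ → link) (rooted-at {c = c} ≤-refl spokes-j nothing-later)
                                        (blocksFrom (λ { k refl → link }) next)
        where j≤n = subst (j ≤_) j+r+1≡n (m≤m+n j (suc r))
      ... | bareCut | next = closing j≤n (λ _ → link) (bare-rooted spokes-j nothing-later)
                                     (blocksFrom (λ { k refl → link }) next)
        where j≤n = subst (j ≤_) j+r+1≡n (m≤m+n j (suc r))
      ... | spokeLink c | next =
        extending next link (rooted-at {c = c} (<⇒≤ (Suffix.j≤end next)) spokes-j (Suffix.rest next))
      ... | bareLink {unrooted} | next = extending next link (bare-unrooted spokes-j (Suffix.rest next))
      ... | bareLink {rooted} | next = extending next link (bare-rooted spokes-j (Suffix.rest next))

      module _ (w : Word unrooted 0 n) (realises : Realises S w) where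

        block : ∀ x → x ≤ n → Block x
        block x x≤n = blocksFrom (λ _ ()) (suffix w refl realises) x z≤n x≤n

        reach-hub : ∀ x → x ≤ n → Reach G S (vertex x) hub
        reach-hub x x≤n =
          Reach-trans G to-root (edge⇒Reach G _ (lookup⇒[]= _ S root-selected) (spokeEdge-ends rootSpoke root≤n))
          where
          open Block (block x x≤n)
          root≤n = ≤-trans root≤end end≤n
          linked-∈ : ∀ {k} → start ≤ k → k < end → pathEdge k ∈ S
          linked-∈ start≤k k<end = lookup⇒[]= _ S (linked-inside _ start≤k k<end)
          to-root : Reach G S (vertex x) (vertex root)
          to-root with x ≤? root
          ... | yes x≤root =
            walk x≤root root≤n λ k x≤k k<root → linked-∈ (≤-trans start≤x x≤k) (<-≤-trans k<root root≤end)
          ... | no x≰root =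
            Reach-sym G (walk (<⇒≤ (≰⇒> x≰root)) x≤n λ k root≤k k<x →
              linked-∈ (≤-trans start≤root root≤k) (<-≤-trans k<x x≤end))

        private
          module Outside {x} (B : Block x) (e : Fin (length G)) where
            open Block B
            cut-before-block : ∀ k → k < n → pathEdge k ∈ S - e → suc k ≢ start
            cut-before-block k _ k∈ sk≡start = lookup≡false⇒∉ (cut-before k sk≡start) (x∈p-y⇒x∈p k∈)
            cut-after-block : ∀ k → k < n → pathEdge k ∈ S - e → k ≢ end
            cut-after-block k k<n k∈ refl = lookup≡false⇒∉ (cut-after k<n) (x∈p-y⇒x∈p k∈)
            at-root : ∀ k c → start ≤ k → k ≤ end → spokeEdge k c ∈ S - e →
                      spokeEdge k c ≡ spokeEdge root rootSpoke
            at-root k c start≤k k≤end k∈ = root-unique k c start≤k k≤end ([]=⇒lookup (x∈p-y⇒x∈p k∈))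

        spoke-acyclic : ∀ k c → k ≤ n → spokeEdge k c ∈ S → ¬ Reach G (S - spokeEdge k c) (vertex k) hub
        spoke-acyclic k c k≤n e∈S = Isolated⇒¬Reach-hub isolated start≤x x≤end
          where
          B = block k k≤n
          open Block B
          open Outside B (spokeEdge k c)
          isolated : Isolated (S - spokeEdge k c) start end
          isolated = record
            { hi≤n = end≤n ; cut-before = cut-before-block ; cut-after = cut-after-block
            ; spokeless = λ k' c' start≤k' k'≤end k'∈ →
                x∈p-y⇒x≢y k'∈ (trans (at-root k' c' start≤k' k'≤end k'∈)
                                     (sym (root-unique k c start≤x x≤end ([]=⇒lookup e∈S))))
            }

        -- Removing a path edge splits its run in two, and the half without the run's spoke is cut off.
        path-acyclic : ∀ k → k < n → pathEdge k ∈ S → ¬ Reach G (S - pathEdge k) (vertex k) (vertex (suc k))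
        path-acyclic k k<n e∈S reach = by-root-side (root ≤? k)
          where
          B = block k (<⇒≤ k<n)
          open Block B
          open Outside B (pathEdge k)
          k<end : k < end
          k<end = ≤∧≢⇒< x≤end λ k≡end →
            lookup≡false⇒∉ (cut-after (subst (_< n) k≡end k<n)) (subst (λ z → pathEdge z ∈ S) k≡end e∈S)
          removed : ∀ k' → k' < n → pathEdge k' ∈ S - pathEdge k → k' ≢ k
          removed k' _ k'∈ refl = x∈p-y⇒x≢y k'∈ refl
          root-position : ∀ k' c' → start ≤ k' → k' ≤ end → spokeEdge k' c' ∈ S - pathEdge k → k' ≡ root
          root-position k' c' start≤k' k'≤end k'∈ =
            spokeEdge-position (≤-trans k'≤end end≤n) (≤-trans root≤end end≤n) (at-root k' c' start≤k' k'≤end k'∈)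
          right : root ≤ k → Isolated (S - pathEdge k) (suc k) end
          right root≤k = record
            { hi≤n = end≤n
            ; cut-before = λ k' k'<n k'∈ sk'≡sk → removed k' k'<n k'∈ (suc-injective sk'≡sk)
            ; cut-after = cut-after-block
            ; spokeless = λ k' c' sk≤k' k'≤end k'∈ →
                1+n≰n (≤-trans sk≤k' (subst (_≤ k)
                  (sym (root-position k' c' (≤-trans start≤x (<⇒≤ sk≤k')) k'≤end k'∈)) root≤k))
            }
          left : ¬ root ≤ k → Isolated (S - pathEdge k) start k
          left root≰k = record
            { hi≤n = <⇒≤ k<n
            ; cut-before = cut-before-block
            ; cut-after = removed
            ; spokeless = λ k' c' start≤k' k'≤k k'∈ →
                root≰k (subst (_≤ k) (root-position k' c' start≤k' (≤-trans k'≤k x≤end) k'∈) k'≤k)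
            }
          by-root-side : Dec (root ≤ k) → ⊥
          by-root-side (yes root≤k) =
            Isolated⇒¬Reach-outside (right root≤k) ≤-refl k<end (<⇒≤ k<n) (inj₁ ≤-refl) (Reach-sym G reach)
          by-root-side (no root≰k) =
            Isolated⇒¬Reach-outside (left root≰k) start≤x ≤-refl k<n (inj₂ ≤-refl) reach

        pathEdge-acyclic : ∀ {e k} → e ≡ pathEdge k → k < n → e ∈ S → OnNoCycle G S e
        pathEdge-acyclic {k = k} refl k<n e∈S = ¬Reach⇒OnNoCycle G (pathEdge-ends k<n) (path-acyclic k k<n e∈S)

        spokeEdge-acyclic : ∀ {e k c} → e ≡ spokeEdge k c → k ≤ n → e ∈ S → OnNoCycle G S e
        spokeEdge-acyclic {k = k} {c} refl k≤n e∈S = ¬Reach⇒OnNoCycle G (spokeEdge-ends c k≤n) (spoke-acyclic k c k≤n e∈S)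

module Labellings where
  open import Defs using (Multigraph; ends; pathEdges)
  open import Data.Nat using (zero; suc)
  open import Data.Empty using (⊥; ⊥-elim)
  open import Data.Fin using (Fin; zero; suc; inject₁)
  open import Data.List using (List; []; _∷_; _++_; map; replicate; concatMap; tabulate; length; lookup)
  open import Data.Maybe using (Maybe; just; nothing; maybe)
  open import Data.Product using (Σ; _×_; _,_; proj₁; proj₂; uncurry)
  open import Data.Sum using (_⊎_; inj₁; inj₂; [_,_])
  import Data.Sum as Sum
  open import Function using (_∘_; const)
  open import Function.Bundles using (Inverse; _↔_; mk↔ₛ′)
  open import Function.Properties.Inverse using (↔-trans; ↔-sym)
  open import Data.Fin.Properties using (0↔⊥)
  open import Relation.Binary.PropositionalEquality hiding ([_])

  record Labelling {V : Set} (G : Multigraph V) (E : Set) (endsOf : E → V × V) : Set where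
    field
      labels : Fin (length G) ↔ E
      ends-edge : ∀ a → ends G (Inverse.from labels a) ≡ endsOf a

    edge : E → Fin (length G)
    edge = Inverse.from labels

    label : Fin (length G) → E
    label = Inverse.to labels

    label-edge : ∀ a → label (edge a) ≡ a
    label-edge = Inverse.strictlyInverseˡ labels

    edge-label : ∀ e → edge (label e) ≡ e
    edge-label = Inverse.strictlyInverseʳ labels

  private
    variable
      V W : Set

  relabel : ∀ {G : Multigraph V} {E F en en'} → Labelling G E en → (iso : E ↔ F) →
            (∀ b → en (Inverse.from iso b) ≡ en' b) → Labelling G F en'
  relabel X iso ends-iso = record
    { labels = ↔-trans (Labelling.labels X) iso
    ; ends-edge = λ b → trans (Labelling.ends-edge X (Inverse.from iso b)) (ends-iso b) }

  Maybe↔Fin-suc : ∀ {n} → Maybe (Fin n) ↔ Fin (suc n)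
  Maybe↔Fin-suc = mk↔ₛ′ (maybe suc zero) predecessor (λ { zero → refl ; (suc i) → refl })
                        (λ { nothing → refl ; (just i) → refl })
    where
    predecessor : ∀ {n} → Fin (suc n) → Maybe (Fin n)
    predecessor zero = nothing
    predecessor (suc i) = just i

  labelling-[] : Labelling {V} [] ⊥ ⊥-elim
  labelling-[] = record { labels = mk↔ₛ′ (λ ()) (λ ()) (λ ()) (λ ()) ; ends-edge = λ () }

  labelling-∷ : ∀ {x : V × V} {xs E en} → Labelling xs E en → Labelling (x ∷ xs) (Maybe E) (maybe en x)
  labelling-∷ X = record
    { labels = mk↔ₛ′ to (maybe (suc ∘ edge) zero)
                     (λ { nothing → refl ; (just a) → cong just (label-edge a) })
                     (λ { zero → refl ; (suc e) → cong suc (edge-label e) })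
    ; ends-edge = λ { nothing → refl ; (just a) → ends-edge a } }
    where
    open Labelling X
    to : Fin (suc _) → Maybe _
    to zero = nothing
    to (suc e) = just (label e)

  labelling-++ˡ : ∀ (xs : Multigraph V) {ys F fn} → Labelling ys F fn →
                  Labelling (xs ++ ys) (Fin (length xs) ⊎ F) [ lookup xs , fn ]
  labelling-++ˡ [] Y = relabel Y (mk↔ₛ′ inj₂ [ (λ ()) , (λ b → b) ] (λ { (inj₁ ()) ; (inj₂ b) → refl }) (λ _ → refl))
                                 (λ { (inj₁ ()) ; (inj₂ b) → refl })
  labelling-++ˡ (x ∷ xs) Y = relabel (labelling-∷ (labelling-++ˡ xs Y)) (mk↔ₛ′ to from to-from from-to) ends-from
    where
    to : Maybe (Fin (length xs) ⊎ _) → Fin (suc (length xs)) ⊎ _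
    to = maybe (Sum.map₁ suc) (inj₁ zero)
    from : Fin (suc (length xs)) ⊎ _ → Maybe (Fin (length xs) ⊎ _)
    from (inj₁ zero) = nothing
    from (inj₁ (suc i)) = just (inj₁ i)
    from (inj₂ b) = just (inj₂ b)
    to-from : ∀ b → to (from b) ≡ b
    to-from (inj₁ zero) = refl
    to-from (inj₁ (suc i)) = refl
    to-from (inj₂ b) = refl
    from-to : ∀ a → from (to a) ≡ a
    from-to nothing = refl
    from-to (just (inj₁ i)) = refl
    from-to (just (inj₂ b)) = refl
    ends-from : ∀ b → _ ≡ [ lookup (x ∷ xs) , _ ] b
    ends-from (inj₁ zero) = refl
    ends-from (inj₁ (suc i)) = refl
    ends-from (inj₂ b) = refl

  labelling-++ : ∀ {xs ys : Multigraph V} {E F en fn} → Labelling xs E en → Labelling ys F fn →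
                 Labelling (xs ++ ys) (E ⊎ F) [ en , fn ]
  labelling-++ {xs = xs} X Y = relabel (labelling-++ˡ xs Y)
    (mk↔ₛ′ (Sum.map₁ label) (Sum.map₁ edge)
           (λ { (inj₁ a) → cong inj₁ (label-edge a) ; (inj₂ b) → refl })
           (λ { (inj₁ e) → cong inj₁ (edge-label e) ; (inj₂ b) → refl }))
    (λ { (inj₁ a) → ends-edge a ; (inj₂ b) → refl })
    where open Labelling X

  labelling-map : ∀ (h : V × V → W × W) {xs : Multigraph V} {E en} →
                  Labelling xs E en → Labelling (map h xs) E (h ∘ en)
  labelling-map h {xs = xs} X = relabel (by-position xs) (Labelling.labels X) (cong h ∘ Labelling.ends-edge X)
    where
    by-position : ∀ xs → Labelling (map h xs) (Fin (length xs)) (h ∘ lookup xs)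
    by-position [] = relabel labelling-[] (↔-sym 0↔⊥) (λ ())
    by-position (x ∷ xs) = relabel (labelling-∷ (by-position xs)) Maybe↔Fin-suc
                                   (λ { zero → refl ; (suc i) → refl })

  labelling-replicate : ∀ k (x : V × V) → Labelling (replicate k x) (Fin k) (const x)
  labelling-replicate zero x = relabel labelling-[] (↔-sym 0↔⊥) (λ ())
  labelling-replicate (suc k) x = relabel (labelling-∷ (labelling-replicate k x)) Maybe↔Fin-suc
                                          (λ { zero → refl ; (suc i) → refl })

  labelling-concatMap : ∀ {A : Set} m (t : Fin m → A) (g : A → List (V × V)) (F : Fin m → Set)
    (en : ∀ i → F i → V × V) → (∀ i → Labelling (g (t i)) (F i) (en i)) →
    Labelling (concatMap g (tabulate t)) (Σ (Fin m) F) (uncurry en)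
  labelling-concatMap zero t g F en X =
    relabel labelling-[] (mk↔ₛ′ (λ ()) (λ { (() , _) }) (λ { (() , _) }) (λ ())) (λ { (() , _) })
  labelling-concatMap (suc m) t g F en X =
    relabel (labelling-++ (X zero) (labelling-concatMap m (t ∘ suc) g (F ∘ suc) (en ∘ suc) (X ∘ suc)))
            (mk↔ₛ′ to from (λ { (zero , a) → refl ; (suc i , a) → refl })
                           (λ { (inj₁ a) → refl ; (inj₂ (i , a)) → refl }))
            (λ { (zero , a) → refl ; (suc i , a) → refl })
    where
    to : F zero ⊎ Σ (Fin m) (F ∘ suc) → Σ (Fin (suc m)) F
    to (inj₁ a) = zero , a
    to (inj₂ (i , a)) = suc i , a
    from : Σ (Fin (suc m)) F → F zero ⊎ Σ (Fin m) (F ∘ suc)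
    from (zero , a) = inj₁ a
    from (suc i , a) = inj₂ (i , a)

  labelling-pathEdges : ∀ n → Labelling (pathEdges (suc n)) (Fin n) (λ i → inject₁ i , suc i)
  labelling-pathEdges zero = relabel labelling-[] (↔-sym 0↔⊥) (λ ())
  labelling-pathEdges (suc n) =
    relabel (labelling-∷ (labelling-map (λ p → suc (proj₁ p) , suc (proj₂ p)) (labelling-pathEdges n)))
            Maybe↔Fin-suc (λ { zero → refl ; (suc i) → refl })

module GraphH where
  open import Defs
  open Lists
  open Multigraphs
  open Labellings
  open Fans
  import Data.Integer as ℤ
  open import Data.Integer using (+_)
  open import Data.Integer.Properties using (pos-*)
  open import Data.Nat using (ℕ; zero; suc; _+_; _*_; _∸_; _≤_; _<_; _<ᵇ_; z≤n; s≤s)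
  open import Data.Nat.Properties
  open import Data.Bool using (Bool; true; false; if_then_else_)
  open import Data.Fin using (Fin; zero; suc; toℕ; inject₁)
  open import Data.Fin.Properties using (toℕ<n)
  open import Data.List using (List; length; cartesianProduct)
  open import Data.List.Membership.Propositional.Properties using (∈-cartesianProduct⁺)
  open import Data.List.Relation.Unary.Unique.Propositional.Properties using (cartesianProduct⁺)
  open import Data.Product using (Σ; _×_; _,_; proj₁; proj₂)
  open import Data.Sum using (_⊎_; inj₁; inj₂)
  open import Function using (_∘_; id)
  open import Function.Bundles using (_↔_; mk↔ₛ′)
  open import Relation.Binary.PropositionalEquality
  open import Relation.Nullary using (¬_)
  open import Data.Vec using (lookup; tabulate)
  open import Data.Vec.Properties using (lookup∘tabulate; tabulate∘lookup; tabulate-cong)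
  open import Data.Fin.Subset using (_∈_; _-_)

  -- k as an element of Fin (suc n), with the junk value n for k > n.
  clamp : (n : ℕ) → ℕ → Fin (suc n)
  clamp zero _ = zero
  clamp (suc n) zero = zero
  clamp (suc n) (suc k) = suc (clamp n k)

  toℕ-clamp : ∀ n {k} → k ≤ n → toℕ (clamp n k) ≡ k
  toℕ-clamp zero z≤n = refl
  toℕ-clamp (suc n) z≤n = refl
  toℕ-clamp (suc n) (s≤s k≤n) = cong suc (toℕ-clamp n k≤n)

  clamp-toℕ : ∀ n (i : Fin (suc n)) → clamp n (toℕ i) ≡ i
  clamp-toℕ zero zero = refl
  clamp-toℕ (suc n) zero = refl
  clamp-toℕ (suc n) (suc i) = cong suc (clamp-toℕ n i)

  inject₁-clamp : ∀ n {k} → k ≤ n → inject₁ (clamp n k) ≡ clamp (suc n) k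
  inject₁-clamp zero z≤n = refl
  inject₁-clamp (suc n) z≤n = refl
  inject₁-clamp (suc n) (s≤s k≤n) = cong suc (inject₁-clamp n k≤n)

  <⇒<ᵇ≡true : ∀ {a b} → a < b → (a <ᵇ b) ≡ true
  <⇒<ᵇ≡true {zero} (s≤s _) = refl
  <⇒<ᵇ≡true {suc a} (s≤s a<b) = <⇒<ᵇ≡true a<b

  n<ᵇn≡false : ∀ n → (n <ᵇ n) ≡ false
  n<ᵇn≡false zero = refl
  n<ᵇn≡false (suc n) = n<ᵇn≡false n

  δ-inner : ∀ r {k} → 0 < k → k < suc r → δ (suc (suc r)) (clamp (suc r) k) ≡ 2
  δ-inner r {suc k} _ (s≤s k<r) =
    cong (λ b → 1 + (if b then 1 else 0))
         (trans (cong (λ x → suc x <ᵇ suc r) (toℕ-clamp r (<⇒≤ k<r))) (<⇒<ᵇ≡true k<r))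

  δ-last : ∀ r → δ (suc (suc r)) (clamp (suc r) (suc r)) ≡ 1
  δ-last r =
    cong (λ b → 1 + (if b then 1 else 0))
         (trans (cong (λ x → suc x <ᵇ suc r) (toℕ-clamp r ≤-refl)) (n<ᵇn≡false (suc r)))

  module TwoFans (p : ℕ) (w : ℕ → ℕ) where

    m : ℕ
    m = suc (suc (suc p))

    spokeCount : ∀ {r} → Fin (suc (suc r)) → ℕ
    spokeCount {r} i = w (toℕ i) ∸ δ (suc (suc r)) i

    data Label : Set where
      topPath : Fin (suc (suc p)) → Label
      bottomPath : Fin (suc p) → Label
      topSpoke : (i : Fin m) → Fin (spokeCount i) → Label
      bottomSpoke : (i : Fin (m ∸ 1)) → Fin (spokeCount i) → Label

    endsOf : Label → Vtx m × Vtx m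
    endsOf (topPath i) = top (inject₁ i) , top (suc i)
    endsOf (bottomPath i) = bot (inject₁ i) , bot (suc i)
    endsOf (topSpoke i _) = top i , ρ
    endsOf (bottomSpoke i _) = bot i , ρ

    ListedLabel : Set
    ListedLabel = Fin (suc (suc p)) ⊎ (Fin (suc p) ⊎
                  (Σ (Fin m) (Fin ∘ spokeCount) ⊎ Σ (Fin (m ∸ 1)) (Fin ∘ spokeCount)))

    ListedLabel↔Label : ListedLabel ↔ Label
    ListedLabel↔Label = mk↔ₛ′ to from
      (λ { (topPath i) → refl ; (bottomPath i) → refl ; (topSpoke i c) → refl ; (bottomSpoke i c) → refl })
      (λ { (inj₁ i) → refl ; (inj₂ (inj₁ i)) → refl ; (inj₂ (inj₂ (inj₁ _))) → refl ; (inj₂ (inj₂ (inj₂ _))) → refl })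
      where
      to : ListedLabel → Label
      to (inj₁ i) = topPath i
      to (inj₂ (inj₁ i)) = bottomPath i
      to (inj₂ (inj₂ (inj₁ (i , c)))) = topSpoke i c
      to (inj₂ (inj₂ (inj₂ (i , c)))) = bottomSpoke i c
      from : Label → ListedLabel
      from (topPath i) = inj₁ i
      from (bottomPath i) = inj₂ (inj₁ i)
      from (topSpoke i c) = inj₂ (inj₂ (inj₁ (i , c)))
      from (bottomSpoke i c) = inj₂ (inj₂ (inj₂ (i , c)))

    opaque
      labelling : Labelling (H m w) Label endsOf
      labelling =
        relabel (labelling-++ (labelling-map (λ q → top (proj₁ q) , top (proj₂ q)) (labelling-pathEdges _))
                (labelling-++ (labelling-map (λ q → bot (proj₁ q) , bot (proj₂ q)) (labelling-pathEdges _))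
                (labelling-++ (labelling-concatMap m id _ _ _ λ i → labelling-replicate (spokeCount i) (top i , ρ))
                              (labelling-concatMap (m ∸ 1) id _ _ _ λ i → labelling-replicate (spokeCount i) (bot i , ρ)))))
                ListedLabel↔Label
                (λ { (topPath i) → refl ; (bottomPath i) → refl ; (topSpoke i c) → refl ; (bottomSpoke i c) → refl })

    open Labelling labelling

    ends-label : ∀ e → ends (H m w) e ≡ endsOf (label e)
    ends-label e = trans (cong (ends (H m w)) (sym (edge-label e))) (ends-edge (label e))

    module Side (r : ℕ) (place : Fin (suc (suc r)) → Vtx m)
                (place-injective : ∀ {i j} → place i ≡ place j → i ≡ j) (place≢ρ : ∀ {i} → place i ≢ ρ)
                (pathLabel : Fin (suc r) → Label) (spokeLabel : (i : Fin (suc (suc r))) → Fin (spokeCount i) → Label)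
                (pathLabel-ends : ∀ i → endsOf (pathLabel i) ≡ (place (inject₁ i) , place (suc i)))
                (spokeLabel-ends : ∀ i c → endsOf (spokeLabel i c) ≡ (place i , ρ))
                (spokeLabel-injective : ∀ {i c c'} → spokeLabel i c ≡ spokeLabel i c' → c ≡ c') where

      fan : Fan (H m w)
      fan = record
        { hub = ρ
        ; n = suc r
        ; vertex = place ∘ clamp (suc r)
        ; spokes = spokeCount ∘ clamp (suc r)
        ; pathEdge = edge ∘ pathLabel ∘ clamp r
        ; spokeEdge = λ k c → edge (spokeLabel (clamp (suc r) k) c)
        ; vertex-injective = λ k≤n l≤n same →
            trans (sym (toℕ-clamp _ k≤n)) (trans (cong toℕ (place-injective same)) (toℕ-clamp _ l≤n))
        ; vertex≢hub = λ _ → place≢ρ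
        ; pathEdge-ends = λ {k} k<n →
            trans (ends-edge _) (trans (pathLabel-ends _)
                  (cong (λ i → place i , place (suc (clamp r k))) (inject₁-clamp r (≤-pred k<n))))
        ; spokeEdge-ends = λ c _ → trans (ends-edge _) (spokeLabel-ends _ c)
        ; spokeEdge-injective = λ _ same →
            spokeLabel-injective (trans (sym (label-edge _)) (trans (cong label same) (label-edge _)))
        }

      open FanWords fan public

      transport-spoke : ∀ {i j} → i ≡ j → (c : Fin (spokeCount j)) →
                        Σ (Fin (spokeCount i)) λ c' → spokeLabel i c' ≡ spokeLabel j c × toℕ c' ≡ toℕ c
      transport-spoke refl c = c , refl , refl

      Describes : EdgeSubset (H m w) → Word unrooted 0 (suc r) → Set
      Describes S u =
        (∀ i → lookup S (edge (pathLabel i)) ≡ linkAt u (toℕ i)) ×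
        (∀ i c → lookup S (edge (spokeLabel i c)) ≡ selectsAt u (toℕ i) (toℕ c))

      Describes⇒Agrees : ∀ {S u} → Describes S u → Agrees S u
      Describes⇒Agrees {S} {u} (path-bits , spoke-bits) =
        (λ k _ k<n → trans (path-bits (clamp r k)) (cong (linkAt u) (toℕ-clamp r (≤-pred k<n)))) ,
        (λ k c _ k≤n → trans (spoke-bits (clamp (suc r) k) c)
                             (cong (λ i → selectsAt u i (toℕ c)) (toℕ-clamp (suc r) k≤n)))

      Agrees⇒Describes : ∀ {S u} → Agrees S u → Describes S u
      Agrees⇒Describes {S} {u} (linked-bits , selected-bits) = path-bits , spoke-bits
        where
        path-bits : ∀ i → lookup S (edge (pathLabel i)) ≡ linkAt u (toℕ i)
        path-bits i = subst (λ j → lookup S (edge (pathLabel j)) ≡ linkAt u (toℕ i)) (clamp-toℕ r i)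
                            (linked-bits (toℕ i) z≤n (toℕ<n i))
        spoke-bits : ∀ i c → lookup S (edge (spokeLabel i c)) ≡ selectsAt u (toℕ i) (toℕ c)
        spoke-bits i c with transport-spoke (clamp-toℕ (suc r) i) c
        ... | c' , same-label , same-index =
          subst₂ (λ a x → lookup S (edge a) ≡ selectsAt u (toℕ i) x) same-label same-index
                 (selected-bits (toℕ i) c' z≤n (≤-pred (toℕ<n i)))

      module _ (w≥2 : ∀ k → k ≤ suc r → 2 ≤ w k) where

        spokes-first : spokes 0 + 1 ≡ w 0
        spokes-first = m∸n+n≡m (≤-trans (s≤s z≤n) (w≥2 0 z≤n))

        spokes-inner : ∀ k → 0 < k → k < suc r → spokes k + 2 ≡ w k
        spokes-inner k 0<k k<n = begin
          w (toℕ i) ∸ δ (suc (suc r)) i + 2 ≡⟨ cong (λ d → w (toℕ i) ∸ d + 2) (δ-inner r 0<k k<n) ⟩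
          w (toℕ i) ∸ 2 + 2                 ≡⟨ m∸n+n≡m (subst (λ x → 2 ≤ w x) k≡i (w≥2 k (<⇒≤ k<n))) ⟩
          w (toℕ i)                         ≡⟨ cong w k≡i ⟨
          w k ∎
          where
          open ≡-Reasoning
          i = clamp (suc r) k
          k≡i = sym (toℕ-clamp (suc r) (<⇒≤ k<n))

        spokes-last : spokes (suc r) + 1 ≡ w (suc r)
        spokes-last = begin
          w (toℕ i) ∸ δ (suc (suc r)) i + 1 ≡⟨ cong (λ d → w (toℕ i) ∸ d + 1) (δ-last r) ⟩
          w (toℕ i) ∸ 1 + 1                 ≡⟨ m∸n+n≡m (subst (λ x → 1 ≤ w x) k≡i (≤-trans (s≤s z≤n) (w≥2 (suc r) ≤-refl))) ⟩
          w (toℕ i)                         ≡⟨ cong w k≡i ⟨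
          w (suc r) ∎
          where
          open ≡-Reasoning
          i = clamp (suc r) (suc r)
          k≡i = sym (toℕ-clamp (suc r) ≤-refl)

        wordCount-continuant : + wordCount unrooted 0 (suc r) ≡ K (suc (suc r)) (λ k → + w k)
        wordCount-continuant =
          WordCounts.wordCount-continuant spokes (suc r) w spokes-first spokes-inner spokes-last (s≤s z≤n)

      data Ownership (a : Label) : Set where
        own-path : ∀ i → a ≡ pathLabel i → Ownership a
        own-spoke : ∀ i c → a ≡ spokeLabel i c → Ownership a
        foreign : (∀ i → proj₁ (endsOf a) ≢ place i × proj₂ (endsOf a) ≢ place i) → Ownership a

      pathEdge-toℕ : ∀ i → pathEdge (toℕ i) ≡ edge (pathLabel i)
      pathEdge-toℕ i = cong (edge ∘ pathLabel) (clamp-toℕ r i)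

      spokeEdge-toℕ : ∀ i c → Σ (Fin (spokes (toℕ i))) λ c' → spokeEdge (toℕ i) c' ≡ edge (spokeLabel i c)
      spokeEdge-toℕ i c with transport-spoke (clamp-toℕ (suc r) i) c
      ... | c' , same-label , _ = c' , cong edge same-label

      module Owned (ownership : ∀ a → Ownership a) where

        classify : ∀ e → FanEdge fan e
        classify e with ownership (label e)
        ... | own-path i eq =
          path (toℕ i) (toℕ<n i) (trans (sym (edge-label e)) (trans (cong edge eq) (sym (pathEdge-toℕ i))))
        ... | own-spoke i c eq with spokeEdge-toℕ i c
        ...   | c' , same-edge =
          spoke (toℕ i) c' (≤-pred (toℕ<n i)) (trans (sym (edge-label e)) (trans (cong edge eq) (sym same-edge)))
        classify e | foreign apart = away λ k _ →
          (λ at-k → proj₁ (apart (clamp (suc r) k)) (trans (cong proj₁ (sym (ends-label e))) at-k)) ,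
          (λ at-k → proj₂ (apart (clamp (suc r) k)) (trans (cong proj₂ (sym (ends-label e))) at-k))

        open FanTheory fan classify public using (module FromRealisation; module FromSpanningTree)

        module _ {S : EdgeSubset (H m w)} {u : Word unrooted 0 (suc r)} (realises : Realises S u) where

          place-reaches-hub : ∀ i → Reach (H m w) S (place i) ρ
          place-reaches-hub i =
            subst (λ v → Reach (H m w) S v ρ) (cong place (clamp-toℕ (suc r) i))
                  (FromRealisation.reach-hub S u realises (toℕ i) (≤-pred (toℕ<n i)))

          pathLabel-acyclic : ∀ i → edge (pathLabel i) ∈ S → OnNoCycle (H m w) S (edge (pathLabel i))
          pathLabel-acyclic i = FromRealisation.pathEdge-acyclic S u realises (sym (pathEdge-toℕ i)) (toℕ<n i)

          spokeLabel-acyclic : ∀ i c → edge (spokeLabel i c) ∈ S → OnNoCycle (H m w) S (edge (spokeLabel i c))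
          spokeLabel-acyclic i c with spokeEdge-toℕ i c
          ... | c' , same-edge = FromRealisation.spokeEdge-acyclic S u realises (sym same-edge) (≤-pred (toℕ<n i))

      Describes⇒Realises : ∀ {S u} → Describes S u → Realises S u
      Describes⇒Realises {S} {u} described = Agrees⇒Realises S u (Describes⇒Agrees {S} {u} described)

      Realises⇒Describes : ∀ {S u} → Realises S u → Describes S u
      Realises⇒Describes {S} {u} realises = Agrees⇒Describes {S} {u} (Realises⇒Agrees S u realises)

    top-injective : ∀ {i j} → top {m} i ≡ top j → i ≡ j
    top-injective refl = refl

    bot-injective : ∀ {i j} → bot {m} i ≡ bot j → i ≡ j
    bot-injective refl = refl

    top≢ρ : ∀ {i} → top {m} i ≢ ρ
    top≢ρ ()

    bot≢ρ : ∀ {i} → bot {m} i ≢ ρ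
    bot≢ρ ()

    topSpoke-injective : ∀ {i c c'} → topSpoke i c ≡ topSpoke i c' → c ≡ c'
    topSpoke-injective refl = refl

    bottomSpoke-injective : ∀ {i c c'} → bottomSpoke i c ≡ bottomSpoke i c' → c ≡ c'
    bottomSpoke-injective refl = refl

    module Top = Side (suc p) top top-injective top≢ρ topPath topSpoke
                      (λ _ → refl) (λ _ _ → refl) topSpoke-injective
    module Bottom = Side p bot bot-injective bot≢ρ bottomPath bottomSpoke
                         (λ _ → refl) (λ _ _ → refl) bottomSpoke-injective

    topOwnership : ∀ a → Top.Ownership a
    topOwnership (topPath i) = Top.own-path i refl
    topOwnership (topSpoke i c) = Top.own-spoke i c refl
    topOwnership (bottomPath _) = Top.foreign λ _ → (λ ()) , (λ ())
    topOwnership (bottomSpoke _ _) = Top.foreign λ _ → (λ ()) , (λ ())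

    bottomOwnership : ∀ a → Bottom.Ownership a
    bottomOwnership (bottomPath i) = Bottom.own-path i refl
    bottomOwnership (bottomSpoke i c) = Bottom.own-spoke i c refl
    bottomOwnership (topPath _) = Bottom.foreign λ _ → (λ ()) , (λ ())
    bottomOwnership (topSpoke _ _) = Bottom.foreign λ _ → (λ ()) , (λ ())

    module TopTrees = Top.Owned topOwnership
    module BottomTrees = Bottom.Owned bottomOwnership

    Pair : Set
    Pair = Top.Word Top.unrooted 0 (suc (suc p)) × Bottom.Word Bottom.unrooted 0 (suc p)

    bit : Pair → Label → Bool
    bit (u , _) (topPath i) = Top.linkAt u (toℕ i)
    bit (_ , v) (bottomPath i) = Bottom.linkAt v (toℕ i)
    bit (u , _) (topSpoke i c) = Top.selectsAt u (toℕ i) (toℕ c)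
    bit (_ , v) (bottomSpoke i c) = Bottom.selectsAt v (toℕ i) (toℕ c)

    encode : Pair → EdgeSubset (H m w)
    encode uv = tabulate (bit uv ∘ label)

    encode-describes : ∀ u v → Top.Describes (encode (u , v)) u × Bottom.Describes (encode (u , v)) v
    encode-describes u v =
      ((λ i → lookup-encode (topPath i)) , (λ i c → lookup-encode (topSpoke i c))) ,
      ((λ i → lookup-encode (bottomPath i)) , (λ i c → lookup-encode (bottomSpoke i c)))
      where
      lookup-encode : ∀ a → lookup (encode (u , v)) (edge a) ≡ bit (u , v) a
      lookup-encode a = trans (lookup∘tabulate (bit (u , v) ∘ label) (edge a)) (cong (bit (u , v)) (label-edge a))

    described⇒encode : ∀ {S u v} → Top.Describes S u → Bottom.Describes S v → encode (u , v) ≡ S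
    described⇒encode {S} {u} {v} (top-paths , top-spokes) (bottom-paths , bottom-spokes) =
      trans (tabulate-cong λ e → trans (bit-lookup (label e)) (cong (lookup S) (edge-label e))) (tabulate∘lookup S)
      where
      bit-lookup : ∀ a → bit (u , v) a ≡ lookup S (edge a)
      bit-lookup (topPath i) = sym (top-paths i)
      bit-lookup (bottomPath i) = sym (bottom-paths i)
      bit-lookup (topSpoke i c) = sym (top-spokes i c)
      bit-lookup (bottomSpoke i c) = sym (bottom-spokes i c)

    encode-injective : ∀ {x y} → encode x ≡ encode y → x ≡ y
    encode-injective {u , v} {u' , v'} same =
      cong₂ _,_ (Top.Realises-injective _ u u' (Top.Describes⇒Realises (proj₁ (encode-describes u v)))
                                              (realised-by-same (proj₁ (encode-describes u' v'))))
                (Bottom.Realises-injective _ v v' (Bottom.Describes⇒Realises (proj₂ (encode-describes u v)))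
                                                 (realised-by-same′ (proj₂ (encode-describes u' v'))))
      where
      realised-by-same : Top.Describes (encode (u' , v')) u' → Top.Realises (encode (u , v)) u'
      realised-by-same d = subst (λ S → Top.Realises S u') (sym same) (Top.Describes⇒Realises d)
      realised-by-same′ : Bottom.Describes (encode (u' , v')) v' → Bottom.Realises (encode (u , v)) v'
      realised-by-same′ d = subst (λ S → Bottom.Realises S v') (sym same) (Bottom.Describes⇒Realises d)

    encode-spanning : ∀ uv → IsSpanningTree (H m w) (encode uv)
    encode-spanning (u , v) = connected , acyclic
      where
      S = encode (u , v)
      top-realised : Top.Realises S u
      top-realised = Top.Describes⇒Realises (proj₁ (encode-describes u v))
      bottom-realised : Bottom.Realises S v
      bottom-realised = Bottom.Describes⇒Realises (proj₂ (encode-describes u v))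
      to-hub : ∀ x → Reach (H m w) S x ρ
      to-hub ρ = here
      to-hub (top i) = TopTrees.place-reaches-hub top-realised i
      to-hub (bot i) = BottomTrees.place-reaches-hub bottom-realised i
      connected : Connected (H m w) S
      connected x y = Reach-trans (H m w) (to-hub x) (Reach-sym (H m w) (to-hub y))
      AcyclicAt : Fin (length (H m w)) → Set
      AcyclicAt e = e ∈ S → OnNoCycle (H m w) S e
      label-acyclic : ∀ a → AcyclicAt (edge a)
      label-acyclic (topPath i) = TopTrees.pathLabel-acyclic top-realised i
      label-acyclic (bottomPath i) = BottomTrees.pathLabel-acyclic bottom-realised i
      label-acyclic (topSpoke i c) = TopTrees.spokeLabel-acyclic top-realised i c
      label-acyclic (bottomSpoke i c) = BottomTrees.spokeLabel-acyclic bottom-realised i c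
      acyclic : Acyclic (H m w) S
      acyclic e = subst AcyclicAt (edge-label e) (label-acyclic (label e))

    spanning⇒encoded : ∀ S → IsSpanningTree (H m w) S → Σ Pair λ uv → encode uv ≡ S
    spanning⇒encoded S tree =
      (u , v) , described⇒encode (Top.Realises⇒Describes top-realised) (Bottom.Realises⇒Describes bottom-realised)
      where
      open TopTrees.FromSpanningTree S tree using () renaming (spanningTree⇒Word to top-word)
      open BottomTrees.FromSpanningTree S tree using () renaming (spanningTree⇒Word to bottom-word)
      u : Top.Word Top.unrooted 0 (suc (suc p))
      u = proj₁ top-word
      top-realised : Top.Realises S u
      top-realised = proj₂ top-word
      v : Bottom.Word Bottom.unrooted 0 (suc p)
      v = proj₁ bottom-word
      bottom-realised : Bottom.Realises S v
      bottom-realised = proj₂ bottom-word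

    topWords : List (Top.Word Top.unrooted 0 (suc (suc p)))
    topWords = Top.words Top.unrooted 0 (suc (suc p))

    bottomWords : List (Bottom.Word Bottom.unrooted 0 (suc p))
    bottomWords = Bottom.words Bottom.unrooted 0 (suc p)

    pairs : List Pair
    pairs = cartesianProduct topWords bottomWords

    H-spanningTreeCount : HasSpanningTreeCount (H m w) (length pairs)
    H-spanningTreeCount =
      spanningTreeCount (H m w) pairs
        (cartesianProduct⁺ (Top.words-unique Top.unrooted 0 (suc (suc p))) (Bottom.words-unique Bottom.unrooted 0 (suc p)))
        (λ (u , v) → ∈-cartesianProduct⁺ (Top.∈-words u) (Bottom.∈-words v))
        encode encode-injective encode-spanning spanning⇒encoded

    length-pairs : (∀ i → i < m → 2 ≤ w i) → + length pairs ≡ K m (λ i → + w i) ℤ.* K (m ∸ 1) (λ i → + w i)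
    length-pairs w≥2 = begin
      + length pairs
        ≡⟨ cong +_ (length-cartesianProductWith _,_ topWords bottomWords) ⟩
      + (length topWords * length bottomWords)
        ≡⟨ cong +_ (cong₂ _*_ (Top.length-words Top.unrooted 0 (suc (suc p)))
                              (Bottom.length-words Bottom.unrooted 0 (suc p))) ⟩
      + (topCount * bottomCount)
        ≡⟨ pos-* topCount bottomCount ⟩
      + topCount ℤ.* + bottomCount
        ≡⟨ cong₂ ℤ._*_ (Top.wordCount-continuant λ k k≤ → w≥2 k (s≤s k≤))
                       (Bottom.wordCount-continuant λ k k≤ → w≥2 k (s≤s (m≤n⇒m≤1+n k≤))) ⟩
      K m (λ i → + w i) ℤ.* K (m ∸ 1) (λ i → + w i) ∎
      where
      open ≡-Reasoning
      topCount bottomCount : ℕ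
      topCount = Top.wordCount Top.unrooted 0 (suc (suc p))
      bottomCount = Bottom.wordCount Bottom.unrooted 0 (suc p)

open import Defs
open import Data.Nat using (ℕ; suc; _≤_; _<_; _∸_; s≤s; z≤n)
open import Data.Integer using (ℤ; +_; _*_)
open import Data.Product using (Σ; _×_; _,_; proj₁)
open import Relation.Binary.PropositionalEquality using (_≡_)
open import Data.List using (length)
open GraphH using (module TwoFans)

proposition3p1 : (m q : ℕ) (w : ℕ → ℕ) → 3 ≤ m → 1 ≤ q →
    ((i : ℕ) → i < m → 2 ≤ w i × w i ≤ suc q) →
    Σ ℕ (λ n → HasSpanningTreeCount (H m w) n ×
      (+ n ≡ K m (λ i → + (w i)) * K (m ∸ 1) (λ i → + (w i))))
proposition3p1 .(suc (suc (suc p))) q w (s≤s (s≤s (s≤s {n = p} z≤n))) _ bounds =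
  length pairs , H-spanningTreeCount , length-pairs (λ i i<m → proj₁ (bounds i i<m))
  where open TwoFans p w
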